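{- Let $a(n)$ denote the number of partitions of $n$ in which no part is congruent to $3$ modulo $6$ (equivalently, the number of partitions of $n$ in which each odd part appears at most twice), so that $\sum_{n\geq 0} a(n)q^n = \frac{f_3}{f_1 f_6}$. Then, as formal power series in $q$, $$\sum_{n\geq 0} a(4n+2)q^n = 2\,\frac{f_2f_6^2f_8^2}{f_1^4f_3f_{12}}.$$
   Context: For every positive integer $r$, $f_r := \prod_{i\geq 1}(1-q^{ri}) = (1-q^r)(1-q^{2r})(1-q^{3r})\cdots$. -}

module Defs where

open import Data.Nat as ℕ using (ℕ; zero; suc; _∸_; _%_; _≡ᵇ_; _≤ᵇ_)
open import Data.Integer as ℤ using (ℤ; +_; -_)
open import Data.Bool using (if_then_else_)
open import Data.List using (List; upTo; map)
open import Data.Nat.ListAction using (sum)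
open import Data.Vec using (Vec; []; _∷_; head; lookup; allFin)
import Data.Vec as Vec
open import Data.Fin using (Fin; toℕ)

-- A partition is determined by the multiplicity c of each part size;
-- the recursion chooses the multiplicity c of the largest size (suc m).
P : ℕ → ℕ → ℕ
P zero n = if n ≡ᵇ 0 then 1 else 0
P (suc m) n =
  if (suc m % 6) ≡ᵇ 3
  then P m n
  else sum (map (λ c → if (c ℕ.* suc m) ≤ᵇ n then P m (n ∸ c ℕ.* suc m) else 0)
                (upTo (suc n)))

-- a n = number of partitions of n with no part congruent to 3 mod 6
-- (parts are at most n, so P n n counts all of them)
a : ℕ → ℕ
a n = P n n

FPS : Set
FPS = ℕ → ℤ

sumℤ : List ℤ → ℤ
sumℤ = Data.List.foldr ℤ._+_ (+ 0)

infixl 7 _⊛_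
_⊛_ : FPS → FPS → FPS
(f ⊛ g) n = sumℤ (map (λ k → f k ℤ.* g (n ∸ k)) (upTo (suc n)))

_·_ : ℤ → FPS → FPS
(c · f) n = c ℤ.* f n

_⊖_ : FPS → FPS → FPS
(f ⊖ g) n = f n ℤ.- g n

qpow : ℕ → FPS
qpow k n = if n ≡ᵇ k then + 1 else + 0

one : FPS
one = qpow 0

_^^_ : FPS → ℕ → FPS
f ^^ zero = one
f ^^ suc k = f ⊛ (f ^^ k)

-- Multiplicative inverse of a power series with constant term 1:
-- b 0 = 1, b (n+1) = - Σ_{k=1}^{n+1} c k * b (n+1-k).
-- invAux c n = (b n , b (n-1) , … , b 0).
invAux : FPS → (n : ℕ) → Vec ℤ (suc n)
invAux c zero = + 1 ∷ []
invAux c (suc n) =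
  let bs = invAux c n in
  (- Vec.foldr _ ℤ._+_ (+ 0)
       (Vec.map (λ j → c (suc (toℕ j)) ℤ.* lookup bs j) (allFin (suc n))))
  ∷ bs

inv : FPS → FPS
inv c n = head (invAux c n)

fprod : ℕ → ℕ → FPS
fprod r zero = one
fprod r (suc m) = fprod r m ⊛ (one ⊖ qpow (r ℕ.* suc m))

-- f_r = ∏_{i≥1} (1 - q^{r i}); for r ≥ 1 the coefficient of q^n only
-- depends on the factors with i ≤ n.
f : ℕ → FPS
f r n = fprod r n n

-- Write A = Σ a(n) qⁿ = 1 / ∏_{k ≢ 3 (mod 6)} (1 - qᵏ), so that A f₁ = (q³; q⁶)_∞ and A f₁ f₆ = f₃.
-- Ramanujan's theta function f(q^s, q^t) equals f_{s+t} (-q^s; q^{s+t})_∞ (-q^t; q^{s+t})_∞ by the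
-- Jacobi triple product (proved from its finite form with Gaussian binomial coefficients), and since
-- (-x; q)_∞ = (x²; q²)_∞ / (x; q)_∞, splitting every product into residue classes yields
--   f(q, q⁵) = f₂² f₃ f₁₂ / (f₁ f₄ f₆),   φ(q) = f(q, q) = f₂⁵ / (f₁² f₄²),
--   f(q², q⁴) = f₄ f₆² / (f₂ f₁₂),        ψ(q⁴) = f(q¹², q⁴) = f₈² / f₄.
-- Hence A = f₄ f(q, q⁵) / (f₂² f₁₂). The even-index terms of f(q, q⁵) have exponents 2·(those of
-- f(q⁴, q⁸)) and the others odd exponents, so Σ a(2n) qⁿ = f₂ f(q⁴, q⁸) / (f₁² f₆). Writing
-- 1/f₁² = φ(q) f₄² / f₂⁵ leaves φ(q) as the only factor that is not a series in q², and the odd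
-- part of φ(q) is 2 ψ(q⁴); thus Σ a(4n+2) qⁿ = 2 f₂² f(q², q⁴) ψ(q⁴) / (f₁⁴ f₃), which the product
-- formulas turn into the claim.

module Submission where

open import Defs
open import Data.Nat using (ℕ; _+_; _*_)
open import Data.Integer using (+_)
open import Relation.Binary.PropositionalEquality using (_≡_)

open import Algebra.Bundles using (CommutativeRing)
open import Algebra.Structures using (IsCommutativeRing)
import Algebra.Properties.CommutativeSemigroup as CommSemigroupProperties
import Algebra.Properties.Ring as RingProperties
import Algebra.Solver.Ring
import Algebra.Solver.Ring.AlmostCommutativeRing as ACR
open import Data.Bool using (Bool; true; false; if_then_else_)
open import Data.Fin using (Fin; toℕ) renaming (zero to fzero; suc to fsuc)
open import Data.Integer as ℤ using (ℤ)
import Data.Integer.Properties as ℤₚ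
open import Data.List using (List; []; _∷_; _++_; map; concat; foldr; upTo; applyUpTo; applyDownFrom)
import Data.List.Properties as Listₚ
open import Data.List.Relation.Binary.Permutation.Propositional using (_↭_; ↭⇒↭ₛ′)
open import Data.List.Relation.Binary.Permutation.Propositional.Properties using (map⁺)
import Data.List.Relation.Binary.Permutation.Setoid.Properties as SetoidPermutation
open import Data.List.Relation.Binary.Pointwise using (Pointwise; []; _∷_)
import Data.Maybe as Maybe
open import Data.Nat as ℕ
  using (zero; suc; _∸_; _≤_; _<_; _≤ᵇ_; _≡ᵇ_; _%_; _≤?_; ∣_-_∣; z≤n; s≤s; NonZero; nonZero)
import Data.Nat.Properties as ℕₚ
open import Data.List.Sort.InsertionSort ℕₚ.≤-decTotalOrder using (sort)
open import Data.List.Sort.InsertionSort.Properties ℕₚ.≤-decTotalOrder using (sort-↭)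
open import Data.Nat.DivMod using ([m+kn]%n≡m%n)
open import Data.Nat.ListAction using (sum)
open import Data.Nat.Tactic.RingSolver using (solve-∀)
open import Data.Product using (_,_)
open import Data.Vec as Vec using (Vec; lookup; tabulate)
import Data.Vec.Properties as Vecₚ
open import Function using (_∘_; id)
open import Relation.Binary.Bundles using (Setoid)
open import Relation.Binary.PropositionalEquality using (refl; sym; trans; cong; cong₂; subst; module ≡-Reasoning)
import Relation.Binary.Reasoning.Setoid as SetoidReasoning
open import Relation.Binary.Structures using (IsEquivalence)
open import Relation.Nullary using (yes; no; contradiction)
open import Relation.Nullary.Decidable using (dec⇒maybe)
open import Relation.Nullary.Reflects using (ofʸ)

private
  module ℤ+ = CommSemigroupProperties ℤₚ.+-commutativeSemigroup

infix 4 _≈_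
record _≈_ (F G : FPS) : Set where
  constructor coeffwise
  field coeff : ∀ n → F n ≡ G n
open _≈_ public

infixl 6 _⊕_
infixl 7 _⊙_
infix  8 ⊝_

_⊕_ : FPS → FPS → FPS
(F ⊕ G) n = F n ℤ.+ G n

⊝_ : FPS → FPS
(⊝ F) n = ℤ.- F n

𝟘 : FPS
𝟘 _ = + 0

tail : FPS → FPS
tail F n = F (suc n)

-- Defs._⊛_ by recursion on the degree instead of as a list sum (see ⊛≈⊙).
_⊙_ : FPS → FPS → FPS
(F ⊙ G) zero    = F 0 ℤ.* G 0
(F ⊙ G) (suc n) = F 0 ℤ.* G (suc n) ℤ.+ (tail F ⊙ G) n

⊙-coeff-local : ∀ n {F F′ G G′} → (∀ k → k ≤ n → F k ≡ F′ k) → (∀ k → k ≤ n → G k ≡ G′ k) →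
                (F ⊙ G) n ≡ (F′ ⊙ G′) n
⊙-coeff-local zero    F≡ G≡ = cong₂ ℤ._*_ (F≡ 0 z≤n) (G≡ 0 z≤n)
⊙-coeff-local (suc n) F≡ G≡ = cong₂ ℤ._+_ (cong₂ ℤ._*_ (F≡ 0 z≤n) (G≡ (suc n) ℕₚ.≤-refl))
  (⊙-coeff-local n (λ k k≤n → F≡ (suc k) (s≤s k≤n)) (λ k k≤n → G≡ k (ℕₚ.m≤n⇒m≤1+n k≤n)))

≈-refl : ∀ {F} → F ≈ F
≈-refl = coeffwise λ _ → refl

≈-sym : ∀ {F G} → F ≈ G → G ≈ F
≈-sym F≈G = coeffwise λ n → sym (coeff F≈G n)

≈-trans : ∀ {F G H} → F ≈ G → G ≈ H → F ≈ H
≈-trans F≈G G≈H = coeffwise λ n → trans (coeff F≈G n) (coeff G≈H n)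

≈-isEquivalence : IsEquivalence _≈_
≈-isEquivalence = record { refl = ≈-refl ; sym = ≈-sym ; trans = ≈-trans }

⊕-cong : ∀ {F F′ G G′} → F ≈ F′ → G ≈ G′ → F ⊕ G ≈ F′ ⊕ G′
⊕-cong F≈ G≈ = coeffwise λ n → cong₂ ℤ._+_ (coeff F≈ n) (coeff G≈ n)

⊙-cong : ∀ {F F′ G G′} → F ≈ F′ → G ≈ G′ → F ⊙ G ≈ F′ ⊙ G′
⊙-cong F≈ G≈ = coeffwise λ n → ⊙-coeff-local n (λ k _ → coeff F≈ k) (λ k _ → coeff G≈ k)

≡⇒≈ : ∀ {F G} → F ≡ G → F ≈ G
≡⇒≈ refl = ≈-refl

⊕-congˡ : ∀ F {G G′} → G ≈ G′ → F ⊕ G ≈ F ⊕ G′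
⊕-congˡ F = ⊕-cong (≈-refl {F})

⊕-congʳ : ∀ G {F F′} → F ≈ F′ → F ⊕ G ≈ F′ ⊕ G
⊕-congʳ G F≈ = ⊕-cong F≈ (≈-refl {G})

⊙-congˡ : ∀ F {G G′} → G ≈ G′ → F ⊙ G ≈ F ⊙ G′
⊙-congˡ F = ⊙-cong (≈-refl {F})

⊙-congʳ : ∀ G {F F′} → F ≈ F′ → F ⊙ G ≈ F′ ⊙ G
⊙-congʳ G F≈ = ⊙-cong F≈ (≈-refl {G})

⊝-cong : ∀ {F G} → F ≈ G → ⊝ F ≈ ⊝ G
⊝-cong F≈G = coeffwise λ n → cong ℤ.-_ (coeff F≈G n)

⊙-distribʳ : ∀ F G H → (G ⊕ H) ⊙ F ≈ G ⊙ F ⊕ H ⊙ F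
⊙-distribʳ F G H = coeffwise (go G H)
  where
  go : ∀ G H n → ((G ⊕ H) ⊙ F) n ≡ (G ⊙ F ⊕ H ⊙ F) n
  go G H zero    = ℤₚ.*-distribʳ-+ (F 0) (G 0) (H 0)
  go G H (suc n) = trans (cong₂ ℤ._+_ (ℤₚ.*-distribʳ-+ (F (suc n)) (G 0) (H 0)) (go (tail G) (tail H) n))
                         (ℤ+.interchange (G 0 ℤ.* F (suc n)) (H 0 ℤ.* F (suc n)) _ _)

⊙-comm : ∀ F G → F ⊙ G ≈ G ⊙ F
⊙-comm F G = coeffwise (go F G)
  where
  open ≡-Reasoning
  go : ∀ F G n → (F ⊙ G) n ≡ (G ⊙ F) n
  go F G zero          = ℤₚ.*-comm (F 0) (G 0)
  go F G (suc zero)    = trans (cong₂ ℤ._+_ (ℤₚ.*-comm (F 0) (G 1)) (ℤₚ.*-comm (F 1) (G 0)))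
                                (ℤₚ.+-comm (G 1 ℤ.* F 0) (G 0 ℤ.* F 1))
  go F G (suc (suc n)) = begin
    F 0 ℤ.* G (2 + n) ℤ.+ (tail F ⊙ G) (suc n)
      ≡⟨ cong (ℤ._+_ (F 0 ℤ.* G (2 + n))) (go (tail F) G (suc n)) ⟩
    F 0 ℤ.* G (2 + n) ℤ.+ (G 0 ℤ.* F (2 + n) ℤ.+ (tail G ⊙ tail F) n)
      ≡⟨ ℤ+.x∙yz≈y∙xz (F 0 ℤ.* G (2 + n)) (G 0 ℤ.* F (2 + n)) _ ⟩
    G 0 ℤ.* F (2 + n) ℤ.+ (F 0 ℤ.* G (2 + n) ℤ.+ (tail G ⊙ tail F) n)
      ≡⟨ cong (λ x → G 0 ℤ.* F (2 + n) ℤ.+ (F 0 ℤ.* G (2 + n) ℤ.+ x)) (go (tail G) (tail F) n) ⟩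
    G 0 ℤ.* F (2 + n) ℤ.+ (F ⊙ tail G) (suc n)
      ≡⟨ cong (ℤ._+_ (G 0 ℤ.* F (2 + n))) (go F (tail G) (suc n)) ⟩
    (G ⊙ F) (2 + n) ∎

⊙-distribˡ : ∀ F G H → F ⊙ (G ⊕ H) ≈ F ⊙ G ⊕ F ⊙ H
⊙-distribˡ F G H = ≈-trans (⊙-comm F (G ⊕ H))
  (≈-trans (⊙-distribʳ F G H) (⊕-cong (⊙-comm G F) (⊙-comm H F)))

·-⊙ : ∀ c F G → (c · F) ⊙ G ≈ c · (F ⊙ G)
·-⊙ c F G = coeffwise (go F)
  where
  go : ∀ F n → ((c · F) ⊙ G) n ≡ (c · (F ⊙ G)) n
  go F zero    = ℤₚ.*-assoc c (F 0) (G 0)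
  go F (suc n) = trans (cong₂ ℤ._+_ (ℤₚ.*-assoc c (F 0) (G (suc n))) (go (tail F) n))
                       (sym (ℤₚ.*-distribˡ-+ c _ _))

-- The coefficients of degree ≥ 1 of F ⊙ G are those of F 0 · tail G ⊕ tail F ⊙ G.
⊙-assoc : ∀ F G H → (F ⊙ G) ⊙ H ≈ F ⊙ (G ⊙ H)
⊙-assoc F G H = coeffwise (go F G)
  where
  open ≡-Reasoning
  go : ∀ F G n → ((F ⊙ G) ⊙ H) n ≡ (F ⊙ (G ⊙ H)) n
  go F G zero    = ℤₚ.*-assoc (F 0) (G 0) (H 0)
  go F G (suc n) = begin
    (F 0 ℤ.* G 0) ℤ.* H (suc n) ℤ.+ ((F 0 · tail G ⊕ tail F ⊙ G) ⊙ H) n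
      ≡⟨ cong (ℤ._+_ ((F 0 ℤ.* G 0) ℤ.* H (suc n))) (coeff (⊙-distribʳ H (F 0 · tail G) (tail F ⊙ G)) n) ⟩
    (F 0 ℤ.* G 0) ℤ.* H (suc n) ℤ.+ (((F 0 · tail G) ⊙ H) n ℤ.+ ((tail F ⊙ G) ⊙ H) n)
      ≡⟨ cong₂ (λ x y → (F 0 ℤ.* G 0) ℤ.* H (suc n) ℤ.+ (x ℤ.+ y)) (coeff (·-⊙ (F 0) (tail G) H) n) (go (tail F) G n) ⟩
    (F 0 ℤ.* G 0) ℤ.* H (suc n) ℤ.+ (F 0 ℤ.* (tail G ⊙ H) n ℤ.+ (tail F ⊙ (G ⊙ H)) n)
      ≡⟨ ℤₚ.+-assoc ((F 0 ℤ.* G 0) ℤ.* H (suc n)) _ _ ⟨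
    (F 0 ℤ.* G 0) ℤ.* H (suc n) ℤ.+ F 0 ℤ.* (tail G ⊙ H) n ℤ.+ (tail F ⊙ (G ⊙ H)) n
      ≡⟨ cong (λ x → x ℤ.+ (tail F ⊙ (G ⊙ H)) n)
              (trans (cong (λ x → x ℤ.+ F 0 ℤ.* (tail G ⊙ H) n) (ℤₚ.*-assoc (F 0) (G 0) (H (suc n))))
                     (sym (ℤₚ.*-distribˡ-+ (F 0) _ _))) ⟩
    F 0 ℤ.* (G ⊙ H) (suc n) ℤ.+ (tail F ⊙ (G ⊙ H)) n ∎

⊙-identityˡ : ∀ F → one ⊙ F ≈ F
⊙-identityˡ F = coeffwise go
  where
  𝟘⊙ : ∀ n → (𝟘 ⊙ F) n ≡ + 0
  𝟘⊙ zero    = refl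
  𝟘⊙ (suc n) = cong (ℤ._+_ (+ 0)) (𝟘⊙ n)
  go : ∀ n → (one ⊙ F) n ≡ F n
  go zero    = ℤₚ.*-identityˡ (F 0)
  go (suc n) = trans (cong₂ ℤ._+_ (ℤₚ.*-identityˡ (F (suc n))) (𝟘⊙ n)) (ℤₚ.+-identityʳ _)

⊙-isCommutativeRing : IsCommutativeRing _≈_ _⊕_ _⊙_ ⊝_ 𝟘 one
⊙-isCommutativeRing = record
  { isRing = record
    { +-isAbelianGroup = record
      { isGroup = record
        { isMonoid = record
          { isSemigroup = record
            { isMagma = record { isEquivalence = ≈-isEquivalence ; ∙-cong = ⊕-cong }
            ; assoc = λ F G H → coeffwise λ n → ℤₚ.+-assoc (F n) (G n) (H n) }
          ; identity = (λ F → coeffwise λ n → ℤₚ.+-identityˡ (F n))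
                     , (λ F → coeffwise λ n → ℤₚ.+-identityʳ (F n)) }
        ; inverse = (λ F → coeffwise λ n → ℤₚ.+-inverseˡ (F n))
                  , (λ F → coeffwise λ n → ℤₚ.+-inverseʳ (F n))
        ; ⁻¹-cong = ⊝-cong }
      ; comm = λ F G → coeffwise λ n → ℤₚ.+-comm (F n) (G n) }
    ; *-cong = ⊙-cong
    ; *-assoc = ⊙-assoc
    ; *-identity = ⊙-identityˡ , λ F → ≈-trans (⊙-comm F one) (⊙-identityˡ F)
    ; distrib = ⊙-distribˡ , ⊙-distribʳ }
  ; *-comm = ⊙-comm }

PowerSeries : CommutativeRing _ _
PowerSeries = record { isCommutativeRing = ⊙-isCommutativeRing }

open CommutativeRing PowerSeries
  using (*-commutativeSemigroup; *-identityʳ; +-identityˡ; +-assoc; +-comm; zeroʳ) renaming (setoid to ≈-setoid)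

private
  module ⊙ = CommSemigroupProperties *-commutativeSemigroup
  module ⊕ = CommSemigroupProperties (CommutativeRing.+-commutativeSemigroup PowerSeries)

module ≈-Reasoning = SetoidReasoning ≈-setoid

const : ℤ → FPS
const c zero    = c
const c (suc n) = + 0

const-* : ∀ c d → const (c ℤ.* d) ≈ const c ⊙ const d
const-* c d = coeffwise go
  where
  tail-const⊙ : ∀ n → (tail (const c) ⊙ const d) n ≡ + 0
  tail-const⊙ zero    = refl
  tail-const⊙ (suc n) = cong (ℤ._+_ (+ 0)) (tail-const⊙ n)
  go : ∀ n → const (c ℤ.* d) n ≡ (const c ⊙ const d) n
  go zero    = refl
  go (suc n) = sym (trans (cong (ℤ._+_ (c ℤ.* + 0)) (tail-const⊙ n)) (trans (ℤₚ.+-identityʳ _) (ℤₚ.*-zeroʳ c)))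

const-homomorphism : ACR._-Raw-AlmostCommutative⟶_ (CommutativeRing.rawRing ℤₚ.+-*-commutativeRing)
                                                    (ACR.fromCommutativeRing PowerSeries)
const-homomorphism = record
  { ⟦_⟧    = const
  ; +-homo = λ _ _ → coeffwise λ { zero → refl ; (suc n) → refl }
  ; *-homo = const-*
  ; -‿homo = λ _ → coeffwise λ { zero → refl ; (suc n) → refl }
  ; 0-homo = coeffwise λ { zero → refl ; (suc n) → refl }
  ; 1-homo = coeffwise λ { zero → refl ; (suc n) → refl }
  }

const-≟ : ∀ c d → Maybe.Maybe (const c ≈ const d)
const-≟ c d = Maybe.map (λ c≡d → coeffwise λ n → cong (λ x → const x n) c≡d) (dec⇒maybe (c ℤ.≟ d))

one≈const : one ≈ const (+ 1)
one≈const = coeffwise λ { zero → refl ; (suc n) → refl }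

module ⊙-Solver = Algebra.Solver.Ring (CommutativeRing.rawRing ℤₚ.+-*-commutativeRing)
  (ACR.fromCommutativeRing PowerSeries) const-homomorphism const-≟

map-applyUpTo : ∀ {A B : Set} (h : A → B) (g : ℕ → A) m → map h (applyUpTo g m) ≡ applyUpTo (h ∘ g) m
map-applyUpTo h g zero    = refl
map-applyUpTo h g (suc m) = cong (h (g 0) ∷_) (map-applyUpTo h (g ∘ suc) m)

⊛≈⊙ : ∀ F G → F ⊛ G ≈ F ⊙ G
⊛≈⊙ F G = coeffwise λ n → trans (cong sumℤ (map-applyUpTo (λ k → F k ℤ.* G (n ∸ k)) id (suc n))) (sym (go F n))
  where
  go : ∀ F n → (F ⊙ G) n ≡ sumℤ (applyUpTo (λ k → F k ℤ.* G (n ∸ k)) (suc n))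
  go F zero    = sym (ℤₚ.+-identityʳ _)
  go F (suc n) = cong (ℤ._+_ (F 0 ℤ.* G (suc n))) (go (tail F) n)

⊕-self : ∀ U → U ⊕ U ≈ (+ 2) · U
⊕-self U = coeffwise λ n → sym (trans (ℤₚ.*-distribʳ-+ (U n) (+ 1) (+ 1))
  (cong₂ ℤ._+_ (ℤₚ.*-identityˡ (U n)) (ℤₚ.*-identityˡ (U n))))

·-congˡ : ∀ c {U V} → U ≈ V → c · U ≈ c · V
·-congˡ c U≈V = coeffwise λ n → cong (ℤ._*_ c) (coeff U≈V n)

^^-suc : ∀ F k → F ^^ suc k ≈ F ⊙ F ^^ k
^^-suc F k = ⊛≈⊙ F (F ^^ k)

square : ∀ F → F ^^ 2 ≈ F ⊙ F
square F = ≈-trans (^^-suc F 1) (⊙-congˡ F (≈-trans (^^-suc F 0) (*-identityʳ F)))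

infix 4 _≈[_]_
record _≈[_]_ (F : FPS) (D : ℕ) (G : FPS) : Set where
  constructor agreeUpTo
  field coeff≤ : ∀ n → n ≤ D → F n ≡ G n
open _≈[_]_ public

≈⇒≈[] : ∀ {F G} D → F ≈ G → F ≈[ D ] G
≈⇒≈[] D F≈G = agreeUpTo λ n _ → coeff F≈G n

≈[]⇒≈ : ∀ {F G} → (∀ D → F ≈[ D ] G) → F ≈ G
≈[]⇒≈ F≈G = coeffwise λ n → coeff≤ (F≈G n) n ℕₚ.≤-refl

≈[]-sym : ∀ {D F G} → F ≈[ D ] G → G ≈[ D ] F
≈[]-sym F≈G = agreeUpTo λ n n≤D → sym (coeff≤ F≈G n n≤D)

≈[]-trans : ∀ {D F G H} → F ≈[ D ] G → G ≈[ D ] H → F ≈[ D ] H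
≈[]-trans F≈G G≈H = agreeUpTo λ n n≤D → trans (coeff≤ F≈G n n≤D) (coeff≤ G≈H n n≤D)

≈[]-isEquivalence : ∀ D → IsEquivalence (_≈[ D ]_)
≈[]-isEquivalence D = record { refl = ≈⇒≈[] D ≈-refl ; sym = ≈[]-sym ; trans = ≈[]-trans }

≈[]-setoid : ℕ → Setoid _ _
≈[]-setoid D = record { isEquivalence = ≈[]-isEquivalence D }

module ≈[]-Reasoning (D : ℕ) = SetoidReasoning (≈[]-setoid D)

⊕-cong[] : ∀ {D F F′ G G′} → F ≈[ D ] F′ → G ≈[ D ] G′ → F ⊕ G ≈[ D ] F′ ⊕ G′
⊕-cong[] F≈ G≈ = agreeUpTo λ n n≤D → cong₂ ℤ._+_ (coeff≤ F≈ n n≤D) (coeff≤ G≈ n n≤D)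

⊙-cong[] : ∀ {D F F′ G G′} → F ≈[ D ] F′ → G ≈[ D ] G′ → F ⊙ G ≈[ D ] F′ ⊙ G′
⊙-cong[] F≈ G≈ = agreeUpTo λ n n≤D → ⊙-coeff-local n
  (λ k k≤n → coeff≤ F≈ k (ℕₚ.≤-trans k≤n n≤D)) (λ k k≤n → coeff≤ G≈ k (ℕₚ.≤-trans k≤n n≤D))

⊙-congˡ[] : ∀ F {D G G′} → G ≈[ D ] G′ → F ⊙ G ≈[ D ] F ⊙ G′
⊙-congˡ[] F G≈ = ⊙-cong[] (≈⇒≈[] _ (≈-refl {F})) G≈

⊙-congʳ[] : ∀ G {D F F′} → F ≈[ D ] F′ → F ⊙ G ≈[ D ] F′ ⊙ G
⊙-congʳ[] G F≈ = ⊙-cong[] F≈ (≈⇒≈[] _ (≈-refl {G}))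

shift : FPS → FPS
shift U zero    = + 0
shift U (suc n) = U n

shift-cong : ∀ {U V} → U ≈ V → shift U ≈ shift V
shift-cong U≈V = coeffwise λ { zero → refl ; (suc n) → coeff U≈V n }

shift-⊕ : ∀ U V → shift (U ⊕ V) ≈ shift U ⊕ shift V
shift-⊕ U V = coeffwise λ { zero → refl ; (suc n) → refl }

shift-⊙ : ∀ U V → shift U ⊙ V ≈ shift (U ⊙ V)
shift-⊙ U V = coeffwise λ { zero → refl ; (suc n) → ℤₚ.+-identityˡ _ }

shiftBy : ℕ → FPS → FPS
shiftBy zero    V = V
shiftBy (suc e) V = shift (shiftBy e V)

shiftBy-≥ : ∀ e V {n} → e ≤ n → shiftBy e V n ≡ V (n ∸ e)
shiftBy-≥ zero    V _               = refl
shiftBy-≥ (suc e) V {suc n} (s≤s e≤n) = shiftBy-≥ e V e≤n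

shiftBy-< : ∀ e V {n} → n < e → shiftBy e V n ≡ + 0
shiftBy-< (suc e) V {zero}  _         = refl
shiftBy-< (suc e) V {suc n} (s≤s n<e) = shiftBy-< e V n<e

qpow-suc : ∀ e → qpow (suc e) ≈ shift (qpow e)
qpow-suc e = coeffwise λ { zero → refl ; (suc n) → refl }

qpow-⊙ : ∀ e V → qpow e ⊙ V ≈ shiftBy e V
qpow-⊙ zero    V = ⊙-identityˡ V
qpow-⊙ (suc e) V = ≈-trans (⊙-congʳ V (qpow-suc e))
                  (≈-trans (shift-⊙ (qpow e) V) (shift-cong (qpow-⊙ e V)))

qpow-+ : ∀ a b → qpow a ⊙ qpow b ≈ qpow (a + b)
qpow-+ a b = ≈-trans (qpow-⊙ a (qpow b)) (shiftBy-qpow a)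
  where
  shiftBy-qpow : ∀ a → shiftBy a (qpow b) ≈ qpow (a + b)
  shiftBy-qpow zero    = ≈-refl
  shiftBy-qpow (suc a) = ≈-trans (shift-cong (shiftBy-qpow a)) (≈-sym (qpow-suc (a + b)))

qpow-< : ∀ {e n} → n < e → qpow e n ≡ + 0
qpow-< {suc e} {zero}  _         = refl
qpow-< {suc e} {suc n} (s≤s n<e) = qpow-< n<e

infix 8 1-q^_ 1+q^_
1-q^_ 1+q^_ : ℕ → FPS
1-q^ e = one ⊕ ⊝ qpow e
1+q^ e = one ⊕ qpow e

1-q^-≈[]one : ∀ {D e} → D < e → 1-q^ e ≈[ D ] one
1-q^-≈[]one D<e = agreeUpTo λ n n≤D →
  trans (cong (λ x → one n ℤ.+ ℤ.- x) (qpow-< (ℕₚ.≤-<-trans n≤D D<e))) (ℤₚ.+-identityʳ _)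

1+q^-≈[]one : ∀ {D e} → D < e → 1+q^ e ≈[ D ] one
1+q^-≈[]one D<e = agreeUpTo λ n n≤D →
  trans (cong (ℤ._+_ (one n)) (qpow-< (ℕₚ.≤-<-trans n≤D D<e))) (ℤₚ.+-identityʳ _)

1+q^⊙1-q^ : ∀ e → 1+q^ e ⊙ 1-q^ e ≈ 1-q^ (e + e)
1+q^⊙1-q^ e = ≈-trans (difference-of-squares one (qpow e))
  (⊕-cong (⊙-identityˡ one) (coeffwise λ n → cong ℤ.-_ (coeff (qpow-+ e e) n)))
  where
  open ⊙-Solver
  difference-of-squares : ∀ u y → (u ⊕ y) ⊙ (u ⊕ ⊝ y) ≈ u ⊙ u ⊕ ⊝ (y ⊙ y)
  difference-of-squares = solve 2 (λ u y → (u :+ y) :* (u :- y) := u :* u :- y :* y) ≈-refl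

qpow-≈[]𝟘 : ∀ {D e} → D < e → qpow e ≈[ D ] 𝟘
qpow-≈[]𝟘 D<e = agreeUpTo λ n n≤D → qpow-< (ℕₚ.≤-<-trans n≤D D<e)

1-q^-⊙ : ∀ e U → 1-q^ e ⊙ U ≈ U ⊕ ⊝ shiftBy e U
1-q^-⊙ e U = ≈-trans (⊙-distribʳ U one (⊝ qpow e))
  (⊕-cong (⊙-identityˡ U) (≈-trans (≈-sym (-‿distribˡ-* (qpow e) U)) (⊝-cong (qpow-⊙ e U))))
  where open RingProperties (CommutativeRing.ring PowerSeries) using (-‿distribˡ-*)

private
  sumVec : ∀ {n} → Vec ℤ n → ℤ
  sumVec = Vec.foldr _ ℤ._+_ (+ 0)

  ⊙-as-sumVec : ∀ F G n → (F ⊙ G) n ≡ sumVec (tabulate {suc n} λ j → F (toℕ j) ℤ.* G (n ∸ toℕ j))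
  ⊙-as-sumVec F G zero    = sym (ℤₚ.+-identityʳ _)
  ⊙-as-sumVec F G (suc n) = cong (ℤ._+_ (F 0 ℤ.* G (suc n))) (⊙-as-sumVec (tail F) G n)

  lookup-invAux : ∀ c n (j : Fin (suc n)) → lookup (invAux c n) j ≡ inv c (n ∸ toℕ j)
  lookup-invAux c zero    fzero    = refl
  lookup-invAux c (suc n) fzero    = refl
  lookup-invAux c (suc n) (fsuc j) = lookup-invAux c n j

inv-suc : ∀ c n → inv c (suc n) ≡ ℤ.- (tail c ⊙ inv c) n
inv-suc c n = cong ℤ.-_ (begin
  sumVec (Vec.map (λ j → c (suc (toℕ j)) ℤ.* lookup (invAux c n) j) (Vec.allFin (suc n)))
    ≡⟨ cong sumVec (Vecₚ.tabulate-allFin (λ j → c (suc (toℕ j)) ℤ.* lookup (invAux c n) j)) ⟨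
  sumVec {suc n} (tabulate λ j → c (suc (toℕ j)) ℤ.* lookup (invAux c n) j)
    ≡⟨ cong sumVec (Vecₚ.tabulate-cong λ j → cong (ℤ._*_ (c (suc (toℕ j)))) (lookup-invAux c n j)) ⟩
  sumVec {suc n} (tabulate λ j → c (suc (toℕ j)) ℤ.* inv c (n ∸ toℕ j))
    ≡⟨ ⊙-as-sumVec (tail c) (inv c) n ⟨
  (tail c ⊙ inv c) n ∎)
  where open ≡-Reasoning

⊙-inverseʳ : ∀ c → c 0 ≡ + 1 → c ⊙ inv c ≈ one
⊙-inverseʳ c c₀≡1 = coeffwise go
  where
  open ≡-Reasoning
  go : ∀ n → (c ⊙ inv c) n ≡ one n
  go zero    = cong (λ x → x ℤ.* + 1) c₀≡1
  go (suc n) = begin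
    c 0 ℤ.* inv c (suc n) ℤ.+ (tail c ⊙ inv c) n
      ≡⟨ cong (λ x → x ℤ.* inv c (suc n) ℤ.+ (tail c ⊙ inv c) n) c₀≡1 ⟩
    + 1 ℤ.* inv c (suc n) ℤ.+ (tail c ⊙ inv c) n
      ≡⟨ cong (λ x → x ℤ.+ (tail c ⊙ inv c) n) (trans (ℤₚ.*-identityˡ _) (inv-suc c n)) ⟩
    ℤ.- (tail c ⊙ inv c) n ℤ.+ (tail c ⊙ inv c) n   ≡⟨ ℤₚ.+-inverseˡ ((tail c ⊙ inv c) n) ⟩
    + 0                                             ∎

⊙inv-cancelʳ : ∀ {c} → c 0 ≡ + 1 → ∀ U → (U ⊙ c) ⊙ inv c ≈ U
⊙inv-cancelʳ {c} c₀≡1 U =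
  ≈-trans (⊙-assoc U c (inv c)) (≈-trans (⊙-congˡ U (⊙-inverseʳ c c₀≡1)) (*-identityʳ U))

⊙-divideʳ : ∀ {c U V} → c 0 ≡ + 1 → U ⊙ c ≈ V → U ≈ V ⊙ inv c
⊙-divideʳ {c} {U} c₀≡1 Uc≈V = ≈-trans (≈-sym (⊙inv-cancelʳ c₀≡1 U)) (⊙-congʳ (inv c) Uc≈V)

⊙-cancelʳ : ∀ {c U V} → c 0 ≡ + 1 → U ⊙ c ≈ V ⊙ c → U ≈ V
⊙-cancelʳ {c} {U} {V} c₀≡1 Uc≈Vc = ≈-trans (⊙-divideʳ c₀≡1 Uc≈Vc) (⊙inv-cancelʳ c₀≡1 V)

⊙-cancelʳ[] : ∀ {c U V D} → c 0 ≡ + 1 → U ⊙ c ≈[ D ] V ⊙ c → U ≈[ D ] V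
⊙-cancelʳ[] {c} {U} {V} {D} c₀≡1 Uc≈Vc = ≈[]-trans (≈⇒≈[] D (≈-sym (⊙inv-cancelʳ c₀≡1 U)))
  (≈[]-trans (⊙-congʳ[] (inv c) Uc≈Vc) (≈⇒≈[] D (⊙inv-cancelʳ c₀≡1 V)))

-- Infinite products

∏< : (ℕ → FPS) → ℕ → FPS
∏< F zero    = one
∏< F (suc m) = ∏< F m ⊙ F m

∏<-cong : ∀ {F G} m → (∀ k → F k ≈ G k) → ∏< F m ≈ ∏< G m
∏<-cong zero    F≈G = ≈-refl
∏<-cong (suc m) F≈G = ⊙-cong (∏<-cong m F≈G) (F≈G m)

∏<-cong-< : ∀ {F G} m → (∀ k → k < m → F k ≈ G k) → ∏< F m ≈ ∏< G m
∏<-cong-< zero    F≈G = ≈-refl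
∏<-cong-< (suc m) F≈G = ⊙-cong (∏<-cong-< m λ k k<m → F≈G k (ℕₚ.m≤n⇒m≤1+n k<m)) (F≈G m ℕₚ.≤-refl)

∏<-cong[] : ∀ {F G D} m → (∀ k → F k ≈[ D ] G k) → ∏< F m ≈[ D ] ∏< G m
∏<-cong[] zero    F≈G = ≈⇒≈[] _ ≈-refl
∏<-cong[] (suc m) F≈G = ⊙-cong[] (∏<-cong[] m F≈G) (F≈G m)

∏<-⊙ : ∀ F G m → ∏< (λ k → F k ⊙ G k) m ≈ ∏< F m ⊙ ∏< G m
∏<-⊙ F G zero    = ≈-sym (⊙-identityˡ one)
∏<-⊙ F G (suc m) = ≈-trans (⊙-congʳ (F m ⊙ G m) (∏<-⊙ F G m)) (⊙.interchange (∏< F m) (∏< G m) (F m) (G m))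

∏<-+ : ∀ F a b → ∏< F (a + b) ≈ ∏< F a ⊙ ∏< (λ k → F (a + k)) b
∏<-+ F a zero    = ≈-trans (≡⇒≈ (cong (∏< F) (ℕₚ.+-identityʳ a))) (≈-sym (*-identityʳ _))
∏<-+ F a (suc b) = ≈-trans (≡⇒≈ (cong (∏< F) (ℕₚ.+-suc a b)))
  (≈-trans (⊙-congʳ (F (a + b)) (∏<-+ F a b)) (⊙-assoc _ _ _))

∏<-one : ∀ m → ∏< (λ _ → one) m ≈ one
∏<-one zero    = ≈-refl
∏<-one (suc m) = ≈-trans (*-identityʳ _) (∏<-one m)

∏<-residues : ∀ F d M → ∏< F (M * d) ≈ ∏< (λ r → ∏< (λ k → F (k * d + r)) M) d
∏<-residues F d zero    = ≈-sym (∏<-one d)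
∏<-residues F d (suc M) = begin
  ∏< F (d + M * d)                                ≈⟨ ≡⇒≈ (cong (∏< F) (ℕₚ.+-comm d (M * d))) ⟩
  ∏< F (M * d + d)                                ≈⟨ ∏<-+ F (M * d) d ⟩
  ∏< F (M * d) ⊙ ∏< (λ r → F (M * d + r)) d       ≈⟨ ⊙-cong (∏<-residues F d M) ≈-refl ⟩
  ∏< (λ r → ∏< (λ k → F (k * d + r)) M) d ⊙ ∏< (λ r → F (M * d + r)) d
                                                  ≈⟨ ∏<-⊙ _ _ d ⟨
  ∏< (λ r → ∏< (λ k → F (k * d + r)) (suc M)) d   ∎
  where open ≈-Reasoning

TendsToOne : (ℕ → FPS) → Set
TendsToOne F = ∀ {D k} → D ≤ k → F k ≈[ D ] one

∏<-stable : ∀ {F} → TendsToOne F → ∀ {D m} → D ≤ m → ∏< F m ≈[ D ] ∏< F D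
∏<-stable {F} F→1 {D} {m} D≤m = subst (λ m → ∏< F m ≈[ D ] ∏< F D) (ℕₚ.m+[n∸m]≡n D≤m) (go (m ∸ D))
  where
  open ≈[]-Reasoning D
  go : ∀ d → ∏< F (D + d) ≈[ D ] ∏< F D
  go zero    = ≈⇒≈[] D (≡⇒≈ (cong (∏< F) (ℕₚ.+-identityʳ D)))
  go (suc d) = begin
    ∏< F (D + suc d)         ≈⟨ ≈⇒≈[] D (≡⇒≈ (cong (∏< F) (ℕₚ.+-suc D d))) ⟩
    ∏< F (D + d) ⊙ F (D + d) ≈⟨ ⊙-cong[] (go d) (F→1 (ℕₚ.m≤m+n D d)) ⟩
    ∏< F D ⊙ one             ≈⟨ ≈⇒≈[] D (*-identityʳ _) ⟩
    ∏< F D                   ∎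

-- Meaningful for TendsToOne F only: then ∏< F n and ∏< F m agree up to degree n for m ≥ n.
∏∞ : (ℕ → FPS) → FPS
∏∞ F n = ∏< F n n

∏∞-approx : ∀ {F} → TendsToOne F → ∀ {D m} → D ≤ m → ∏∞ F ≈[ D ] ∏< F m
∏∞-approx F→1 D≤m = agreeUpTo λ n n≤D →
  sym (coeff≤ (∏<-stable F→1 (ℕₚ.≤-trans n≤D D≤m)) n ℕₚ.≤-refl)

∏∞-cong : ∀ {F G} → (∀ k → F k ≈ G k) → ∏∞ F ≈ ∏∞ G
∏∞-cong F≈G = coeffwise λ n → coeff (∏<-cong n F≈G) n

∏∞-one : ∏∞ (λ _ → one) ≈ one
∏∞-one = coeffwise λ n → coeff (∏<-one n) n

⊙-tendsToOne : ∀ {F G} → TendsToOne F → TendsToOne G → TendsToOne (λ k → F k ⊙ G k)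
⊙-tendsToOne F→1 G→1 {D} D≤k = ≈[]-trans (⊙-cong[] (F→1 D≤k) (G→1 D≤k)) (≈⇒≈[] D (⊙-identityˡ one))

∏∞-⊙ : ∀ {F G} → TendsToOne F → TendsToOne G → ∏∞ F ⊙ ∏∞ G ≈ ∏∞ (λ k → F k ⊙ G k)
∏∞-⊙ {F} {G} F→1 G→1 = ≈[]⇒≈ λ D → let open ≈[]-Reasoning D in begin
  ∏∞ F ⊙ ∏∞ G                  ≈⟨ ⊙-cong[] (∏∞-approx F→1 ℕₚ.≤-refl) (∏∞-approx G→1 ℕₚ.≤-refl) ⟩
  ∏< F D ⊙ ∏< G D              ≈⟨ ≈⇒≈[] D (∏<-⊙ F G D) ⟨
  ∏< (λ k → F k ⊙ G k) D       ≈⟨ ∏∞-approx (⊙-tendsToOne F→1 G→1) ℕₚ.≤-refl ⟨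
  ∏∞ (λ k → F k ⊙ G k)         ∎

∏∞-residues : ∀ {F} → TendsToOne F → ∀ d .{{_ : NonZero d}} →
              ∏∞ F ≈ ∏< (λ r → ∏∞ (λ k → F (k * d + r))) d
∏∞-residues {F} F→1 d = ≈[]⇒≈ λ D → let open ≈[]-Reasoning D in begin
  ∏∞ F                                         ≈⟨ ∏∞-approx F→1 (ℕₚ.m≤m*n D d) ⟩
  ∏< F (D * d)                                 ≈⟨ ≈⇒≈[] D (∏<-residues F d D) ⟩
  ∏< (λ r → ∏< (λ k → F (k * d + r)) D) d      ≈⟨ ∏<-cong[] d (λ r → ∏∞-approx (residue→1 r) ℕₚ.≤-refl) ⟨
  ∏< (λ r → ∏∞ (λ k → F (k * d + r))) d        ∎
  where
  residue→1 : ∀ r → TendsToOne (λ k → F (k * d + r))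
  residue→1 r {k = k} D≤k = F→1 (ℕₚ.≤-trans D≤k (ℕₚ.≤-trans (ℕₚ.m≤m*n k d) (ℕₚ.m≤m+n (k * d) r)))

qPoch qPoch⁺ : ℕ → ℕ → FPS
qPoch  a m = ∏∞ (λ k → 1-q^ (a + k * m))
qPoch⁺ a m = ∏∞ (λ k → 1+q^ (a + k * m))

module _ (a m : ℕ) .{{_ : NonZero a}} .{{_ : NonZero m}} where

  private
    exponent-large : ∀ {D k} → D ≤ k → D < a + k * m
    exponent-large {D} {k} D≤k = ℕₚ.≤-trans (s≤s D≤k) (ℕₚ.+-mono-≤ (ℕ.>-nonZero⁻¹ a) (ℕₚ.m≤m*n k m))

  qPoch-factors→1 : TendsToOne (λ k → 1-q^ (a + k * m))
  qPoch-factors→1 D≤k = 1-q^-≈[]one (exponent-large D≤k)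

  qPoch⁺-factors→1 : TendsToOne (λ k → 1+q^ (a + k * m))
  qPoch⁺-factors→1 D≤k = 1+q^-≈[]one (exponent-large D≤k)

  qPoch⁺⊙qPoch : qPoch⁺ a m ⊙ qPoch a m ≈ qPoch (2 * a) (2 * m)
  qPoch⁺⊙qPoch = ≈-trans (∏∞-⊙ qPoch⁺-factors→1 qPoch-factors→1)
    (∏∞-cong λ k → ≈-trans (1+q^⊙1-q^ (a + k * m)) (≡⇒≈ (cong 1-q^_ (double-exponent a m k))))
    where
    double-exponent : ∀ a m k → (a + k * m) + (a + k * m) ≡ 2 * a + k * (2 * m)
    double-exponent = solve-∀

  qPoch-residues : ∀ d .{{_ : NonZero d}} → qPoch a m ≈ ∏< (λ r → qPoch (a + r * m) (d * m)) d
  qPoch-residues d = ≈-trans (∏∞-residues qPoch-factors→1 d)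
    (∏<-cong d λ r → ∏∞-cong λ k → ≡⇒≈ (cong 1-q^_ (residue-exponent a m d k r)))
    where
    residue-exponent : ∀ a m d k r → a + (k * d + r) * m ≡ (a + r * m) + k * (d * m)
    residue-exponent = solve-∀

f≈qPoch : ∀ r → f r ≈ qPoch r r
f≈qPoch r = coeffwise λ n → coeff (fprod≈∏< n) n
  where
  fprod≈∏< : ∀ m → fprod r m ≈ ∏< (λ k → 1-q^ (r + k * r)) m
  fprod≈∏< zero    = ≈-refl
  fprod≈∏< (suc m) = ≈-trans (⊛≈⊙ (fprod r m) _)
    (⊙-cong (fprod≈∏< m) (≡⇒≈ (cong 1-q^_ (trans (ℕₚ.*-suc r m) (cong (_+_ r) (ℕₚ.*-comm r m))))))

∏ : List FPS → FPS
∏ []            = one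
∏ (F ∷ [])      = F
∏ (F ∷ G ∷ Fs) = F ⊙ ∏ (G ∷ Fs)

∏-∷ : ∀ F Fs → ∏ (F ∷ Fs) ≈ F ⊙ ∏ Fs
∏-∷ F []       = ≈-sym (*-identityʳ F)
∏-∷ F (G ∷ Fs) = ≈-refl

∏-++ : ∀ Fs Gs → ∏ (Fs ++ Gs) ≈ ∏ Fs ⊙ ∏ Gs
∏-++ []       Gs = ≈-sym (⊙-identityˡ _)
∏-++ (F ∷ Fs) Gs = ≈-trans (∏-∷ F (Fs ++ Gs)) (≈-trans (⊙-congˡ F (∏-++ Fs Gs))
  (≈-trans (≈-sym (⊙-assoc F (∏ Fs) (∏ Gs))) (⊙-congʳ (∏ Gs) (≈-sym (∏-∷ F Fs)))))

∏-↭ : ∀ {Fs Gs} → Fs ↭ Gs → ∏ Fs ≈ ∏ Gs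
∏-↭ {Fs} {Gs} Fs↭Gs = ≈-trans (∏≈foldr Fs) (≈-trans (SetoidPermutation.foldr-commMonoid ≈-setoid
  (CommutativeRing.*-isCommutativeMonoid PowerSeries) (↭⇒↭ₛ′ ≈-isEquivalence Fs↭Gs)) (≈-sym (∏≈foldr Gs)))
  where
  ∏≈foldr : ∀ Fs → ∏ Fs ≈ foldr _⊙_ one Fs
  ∏≈foldr []       = ≈-refl
  ∏≈foldr (F ∷ Fs) = ≈-trans (∏-∷ F Fs) (⊙-congˡ F (∏≈foldr Fs))

-- Products of the (q^r; q^M)_∞ depend only on the multiset of the r, so two products of
-- such factors can be compared by sorting their lists of residues.
module Residues (M : ℕ) where

  ∏qPoch : List ℕ → FPS
  ∏qPoch rs = ∏ (map (λ r → qPoch r M) rs)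

  infix 4 _expandsTo_
  record _expandsTo_ (F : FPS) (rs : List ℕ) : Set where
    constructor expansion
    field expanded : F ≈ ∏qPoch rs
  open _expandsTo_

  ∏qPoch-++ : ∀ rs ss → ∏qPoch (rs ++ ss) ≈ ∏qPoch rs ⊙ ∏qPoch ss
  ∏qPoch-++ rs ss = ≈-trans (≡⇒≈ (cong ∏ (Listₚ.map-++ _ rs ss))) (∏-++ (map (λ r → qPoch r M) rs) _)

  ∏-expand : ∀ {Fs rss} → Pointwise _expandsTo_ Fs rss → ∏ Fs ≈ ∏qPoch (concat rss)
  ∏-expand []           = ≈-refl
  ∏-expand {F ∷ Fs} {rs ∷ rss} (F≈ ∷ Fs≈) = ≈-trans (∏-∷ F Fs)
    (≈-trans (⊙-cong (expanded F≈) (∏-expand Fs≈)) (≈-sym (∏qPoch-++ rs (concat rss))))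

  ∏-by-residues : ∀ {Fs Gs rss sss} → Pointwise _expandsTo_ Fs rss → Pointwise _expandsTo_ Gs sss →
                  sort (concat rss) ≡ sort (concat sss) → ∏ Fs ≈ ∏ Gs
  ∏-by-residues {Fs} {Gs} {rss} {sss} Fs≈ Gs≈ same = begin
    ∏ Fs                        ≈⟨ ∏-expand Fs≈ ⟩
    ∏qPoch (concat rss)         ≈⟨ ∏-↭ (map⁺ _ (sort-↭ (concat rss))) ⟨
    ∏qPoch (sort (concat rss))  ≡⟨ cong ∏qPoch same ⟩
    ∏qPoch (sort (concat sss))  ≈⟨ ∏-↭ (map⁺ _ (sort-↭ (concat sss))) ⟩
    ∏qPoch (concat sss)         ≈⟨ ∏-expand Gs≈ ⟨
    ∏ Gs                        ∎
    where open ≈-Reasoning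

  ∏<≈∏qPoch : ∀ g d → ∏< (λ r → qPoch (g r) M) d ≈ ∏qPoch (applyDownFrom g d)
  ∏<≈∏qPoch g zero    = ≈-refl
  ∏<≈∏qPoch g (suc d) = ≈-trans (⊙-comm _ _) (≈-trans (⊙-congˡ (qPoch (g d) M) (∏<≈∏qPoch g d))
    (≈-sym (∏-∷ (qPoch (g d) M) (map (λ r → qPoch r M) (applyDownFrom g d)))))

  qPoch-expands : ∀ a m d .{{_ : NonZero a}} .{{_ : NonZero m}} .{{_ : NonZero d}} → d * m ≡ M →
                  qPoch a m expandsTo applyDownFrom (λ r → a + r * m) d
  qPoch-expands a m d refl = expansion (≈-trans (qPoch-residues a m d) (∏<≈∏qPoch (λ r → a + r * m) d))

  f-expands : ∀ r d .{{_ : NonZero r}} .{{_ : NonZero d}} → d * r ≡ M →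
              f r expandsTo applyDownFrom (λ i → r + i * r) d
  f-expands r d dr≡M = expansion (≈-trans (f≈qPoch r) (expanded (qPoch-expands r r d dr≡M)))

-- 2-dissection

double : ℕ → ℕ
double zero    = zero
double (suc n) = suc (suc (double n))

double≡2* : ∀ n → double n ≡ 2 * n
double≡2* zero    = refl
double≡2* (suc n) = trans (cong (suc ∘ suc) (double≡2* n)) (sym (ℕₚ.*-suc 2 n))

n≤double : ∀ n → n ≤ double n
n≤double zero    = z≤n
n≤double (suc n) = s≤s (ℕₚ.m≤n⇒m≤1+n (n≤double n))

double-4n+2 : ∀ n → double (suc (double n)) ≡ 4 * n + 2
double-4n+2 n = trans (double≡2* _) (trans (cong (λ m → 2 * suc m) (double≡2* n)) (poly n))
  where
  poly : ∀ n → 2 * suc (2 * n) ≡ 4 * n + 2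
  poly = solve-∀

dilate : FPS → FPS
dilate U zero          = U 0
dilate U (suc zero)    = + 0
dilate U (suc (suc n)) = dilate (tail U) n

evenPart oddPart : FPS → FPS
evenPart U n = U (double n)
oddPart  U n = U (suc (double n))

dilate-double : ∀ U n → dilate U (double n) ≡ U n
dilate-double U zero    = refl
dilate-double U (suc n) = dilate-double (tail U) n

dilate-odd : ∀ U n → dilate U (suc (double n)) ≡ + 0
dilate-odd U zero    = refl
dilate-odd U (suc n) = dilate-odd (tail U) n

dissection : ∀ U → U ≈ dilate (evenPart U) ⊕ shift (dilate (oddPart U))
dissection U = coeffwise (go U)
  where
  dilate-suc : ∀ V n → dilate V (suc n) ≡ shift (dilate (tail V)) n
  dilate-suc V zero    = refl
  dilate-suc V (suc n) = refl
  go : ∀ U n → U n ≡ (dilate (evenPart U) ⊕ shift (dilate (oddPart U))) n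
  go U zero          = sym (ℤₚ.+-identityʳ _)
  go U (suc zero)    = sym (ℤₚ.+-identityˡ _)
  go U (suc (suc n)) = trans (go (tail (tail U)) n)
    (cong (ℤ._+_ (dilate (evenPart (tail (tail U))) n)) (sym (dilate-suc (oddPart U) n)))

evenPart-unique : ∀ {U P Q} → U ≈ dilate P ⊕ shift (dilate Q) → evenPart U ≈ P
evenPart-unique {U} {P} {Q} U≈ = coeffwise λ n →
  trans (coeff U≈ (double n)) (trans (cong₂ ℤ._+_ (dilate-double P n) (shifted-vanishes n)) (ℤₚ.+-identityʳ _))
  where
  shifted-vanishes : ∀ n → shift (dilate Q) (double n) ≡ + 0
  shifted-vanishes zero    = refl
  shifted-vanishes (suc n) = dilate-odd Q n

oddPart-unique : ∀ {U P Q} → U ≈ dilate P ⊕ shift (dilate Q) → oddPart U ≈ Q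
oddPart-unique {U} {P} {Q} U≈ = coeffwise λ n →
  trans (coeff U≈ (suc (double n))) (trans (cong₂ ℤ._+_ (dilate-odd P n) (dilate-double Q n)) (ℤₚ.+-identityˡ _))

dilate-cong[] : ∀ {U V D} → U ≈[ D ] V → dilate U ≈[ D ] dilate V
dilate-cong[] U≈V = agreeUpTo λ n n≤D → go n (λ k k≤n → coeff≤ U≈V k (ℕₚ.≤-trans k≤n n≤D))
  where
  go : ∀ n {U V} → (∀ k → k ≤ n → U k ≡ V k) → dilate U n ≡ dilate V n
  go zero          U≡V = U≡V 0 z≤n
  go (suc zero)    U≡V = refl
  go (suc (suc n)) U≡V = go n (λ k k≤n → U≡V (suc k) (s≤s (ℕₚ.m≤n⇒m≤1+n k≤n)))

dilate-cong : ∀ {U V} → U ≈ V → dilate U ≈ dilate V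
dilate-cong U≈V = ≈[]⇒≈ λ D → dilate-cong[] (≈⇒≈[] D U≈V)

dilate-⊕ : ∀ U V → dilate (U ⊕ V) ≈ dilate U ⊕ dilate V
dilate-⊕ U V = coeffwise (go U V)
  where
  go : ∀ U V n → dilate (U ⊕ V) n ≡ (dilate U ⊕ dilate V) n
  go U V zero          = refl
  go U V (suc zero)    = refl
  go U V (suc (suc n)) = go (tail U) (tail V) n

dilate-⊝ : ∀ U → dilate (⊝ U) ≈ ⊝ dilate U
dilate-⊝ U = coeffwise (go U)
  where
  go : ∀ U n → dilate (⊝ U) n ≡ (⊝ dilate U) n
  go U zero          = refl
  go U (suc zero)    = refl
  go U (suc (suc n)) = go (tail U) n

dilate-· : ∀ c U → dilate (c · U) ≈ c · dilate U
dilate-· c U = coeffwise (go U)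
  where
  go : ∀ U n → dilate (c · U) n ≡ (c · dilate U) n
  go U zero          = refl
  go U (suc zero)    = sym (ℤₚ.*-zeroʳ c)
  go U (suc (suc n)) = go (tail U) n

-- tail (U ⊙ V) agrees with U 0 · tail V ⊕ tail U ⊙ V, and tail (tail (dilate U)) is dilate (tail U).
dilate-⊙ : ∀ U V → dilate (U ⊙ V) ≈ dilate U ⊙ dilate V
dilate-⊙ U V = coeffwise (go U)
  where
  open ≡-Reasoning
  go : ∀ U n → dilate (U ⊙ V) n ≡ (dilate U ⊙ dilate V) n
  go U zero          = refl
  go U (suc zero)    = sym (cong (λ x → x ℤ.+ + 0 ℤ.* V 0) (ℤₚ.*-zeroʳ (U 0)))
  go U (suc (suc n)) = begin
    dilate (U 0 · tail V ⊕ tail U ⊙ V) n                 ≡⟨ coeff (dilate-⊕ (U 0 · tail V) (tail U ⊙ V)) n ⟩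
    dilate (U 0 · tail V) n ℤ.+ dilate (tail U ⊙ V) n
      ≡⟨ cong₂ ℤ._+_ (coeff (dilate-· (U 0) (tail V)) n) (go (tail U) n) ⟩
    U 0 ℤ.* dilate (tail V) n ℤ.+ (dilate (tail U) ⊙ dilate V) n
      ≡⟨ cong (ℤ._+_ (U 0 ℤ.* dilate (tail V) n)) (ℤₚ.+-identityˡ _) ⟨
    U 0 ℤ.* dilate (tail V) n ℤ.+ (+ 0 ℤ.* dilate V (suc n) ℤ.+ (dilate (tail U) ⊙ dilate V) n) ∎

dilate-one : dilate one ≈ one
dilate-one = coeffwise go
  where
  go : ∀ n → dilate one n ≡ one n
  go zero          = refl
  go (suc zero)    = refl
  go (suc (suc n)) = dilate-tail-one n
    where
    dilate-tail-one : ∀ n → dilate (tail one) n ≡ + 0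
    dilate-tail-one zero          = refl
    dilate-tail-one (suc zero)    = refl
    dilate-tail-one (suc (suc n)) = dilate-tail-one n

dilate-𝟘 : dilate 𝟘 ≈ 𝟘
dilate-𝟘 = coeffwise go
  where
  go : ∀ n → dilate 𝟘 n ≡ + 0
  go zero          = refl
  go (suc zero)    = refl
  go (suc (suc n)) = go n

dilate-qpow : ∀ e → dilate (qpow e) ≈ qpow (2 * e)
dilate-qpow e = ≈-trans (go e) (≡⇒≈ (cong qpow (double≡2* e)))
  where
  go : ∀ e → dilate (qpow e) ≈ qpow (double e)
  go zero    = dilate-one
  go (suc e) = coeffwise λ where
    zero          → refl
    (suc zero)    → refl
    (suc (suc n)) → coeff (go e) n

dilate-1-q^ : ∀ e → dilate (1-q^ e) ≈ 1-q^ (2 * e)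
dilate-1-q^ e = ≈-trans (dilate-⊕ one (⊝ qpow e)) (⊕-cong dilate-one (≈-trans (dilate-⊝ (qpow e)) (⊝-cong (dilate-qpow e))))

dilate-∏< : ∀ F m → dilate (∏< F m) ≈ ∏< (λ k → dilate (F k)) m
dilate-∏< F zero    = dilate-one
dilate-∏< F (suc m) = ≈-trans (dilate-⊙ (∏< F m) (F m)) (⊙-congʳ (dilate (F m)) (dilate-∏< F m))

dilate-∏∞ : ∀ {F} → TendsToOne F → TendsToOne (λ k → dilate (F k)) → dilate (∏∞ F) ≈ ∏∞ (λ k → dilate (F k))
dilate-∏∞ {F} F→1 dF→1 = ≈[]⇒≈ λ D → let open ≈[]-Reasoning D in begin
  dilate (∏∞ F)                  ≈⟨ dilate-cong[] (∏∞-approx F→1 ℕₚ.≤-refl) ⟩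
  dilate (∏< F D)                ≈⟨ ≈⇒≈[] D (dilate-∏< F D) ⟩
  ∏< (λ k → dilate (F k)) D      ≈⟨ ∏∞-approx dF→1 ℕₚ.≤-refl ⟨
  ∏∞ (λ k → dilate (F k))        ∎

dilate-qPoch : ∀ a m .{{_ : NonZero a}} .{{_ : NonZero m}} → dilate (qPoch a m) ≈ qPoch (2 * a) (2 * m)
dilate-qPoch a m = ≈-trans (dilate-∏∞ (qPoch-factors→1 a m) dilated→1) (∏∞-cong dilated-factor)
  where
  doubled-exponent : ∀ a m k → 2 * (a + k * m) ≡ 2 * a + k * (2 * m)
  doubled-exponent = solve-∀
  dilated-factor : ∀ k → dilate (1-q^ (a + k * m)) ≈ 1-q^ (2 * a + k * (2 * m))
  dilated-factor k = ≈-trans (dilate-1-q^ (a + k * m)) (≡⇒≈ (cong 1-q^_ (doubled-exponent a m k)))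
  dilated→1 : TendsToOne (λ k → dilate (1-q^ (a + k * m)))
  dilated→1 {D} {k} D≤k = ≈[]-trans (≈⇒≈[] D (dilated-factor k))
    (qPoch-factors→1 (2 * a) (2 * m) {{ℕₚ.m*n≢0 2 a}} {{ℕₚ.m*n≢0 2 m}} D≤k)

dilate-f : ∀ r .{{_ : NonZero r}} → dilate (f r) ≈ f (2 * r)
dilate-f r = ≈-trans (dilate-cong (f≈qPoch r))
  (≈-trans (dilate-qPoch r r) (≈-sym (f≈qPoch (2 * r))))

dilate-f⊙ : ∀ r .{{_ : NonZero r}} U → dilate (f r ⊙ U) ≈ f (2 * r) ⊙ dilate U
dilate-f⊙ r U = ≈-trans (dilate-⊙ (f r) U) (⊙-congʳ (dilate U) (dilate-f r))

evenPart-cong : ∀ {U V} → U ≈ V → evenPart U ≈ evenPart V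
evenPart-cong U≈V = coeffwise λ n → coeff U≈V (double n)

oddPart-cong : ∀ {U V} → U ≈ V → oddPart U ≈ oddPart V
oddPart-cong U≈V = coeffwise λ n → coeff U≈V (suc (double n))

dilate⊙-dissection : ∀ Y U → dilate Y ⊙ U ≈ dilate (Y ⊙ evenPart U) ⊕ shift (dilate (Y ⊙ oddPart U))
dilate⊙-dissection Y U = begin
  dilate Y ⊙ U                                                            ≈⟨ ⊙-congˡ (dilate Y) (dissection U) ⟩
  dilate Y ⊙ (dilate (evenPart U) ⊕ shift (dilate (oddPart U)))          ≈⟨ ⊙-distribˡ _ _ _ ⟩
  dilate Y ⊙ dilate (evenPart U) ⊕ dilate Y ⊙ shift (dilate (oddPart U))
    ≈⟨ ⊕-cong (≈-sym (dilate-⊙ Y _)) (⊙-shift _ _) ⟩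
  dilate (Y ⊙ evenPart U) ⊕ shift (dilate Y ⊙ dilate (oddPart U))
    ≈⟨ ⊕-congˡ (dilate (Y ⊙ evenPart U)) (shift-cong (≈-sym (dilate-⊙ Y (oddPart U)))) ⟩
  dilate (Y ⊙ evenPart U) ⊕ shift (dilate (Y ⊙ oddPart U))               ∎
  where
  open ≈-Reasoning
  ⊙-shift : ∀ U V → U ⊙ shift V ≈ shift (U ⊙ V)
  ⊙-shift U V = ≈-trans (⊙-comm U (shift V)) (≈-trans (shift-⊙ V U) (shift-cong (⊙-comm V U)))

evenPart-dilate⊙ : ∀ Y U → evenPart (dilate Y ⊙ U) ≈ Y ⊙ evenPart U
evenPart-dilate⊙ Y U = evenPart-unique (dilate⊙-dissection Y U)

oddPart-dilate⊙ : ∀ Y U → oddPart (dilate Y ⊙ U) ≈ Y ⊙ oddPart U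
oddPart-dilate⊙ Y U = oddPart-unique (dilate⊙-dissection Y U)

dilate-unique : ∀ {U P} → evenPart U ≈ P → oddPart U ≈ 𝟘 → U ≈ dilate P
dilate-unique {U} {P} even≈ odd≈𝟘 = ≈-trans (dissection U) (coeffwise λ n →
  trans (cong₂ ℤ._+_ (coeff (dilate-cong even≈) n) (coeff (shift-cong (≈-trans (dilate-cong odd≈𝟘) dilate-𝟘)) n))
        (trans (cong (ℤ._+_ (dilate P n)) (shift-𝟘 n)) (ℤₚ.+-identityʳ _)))
  where
  shift-𝟘 : ∀ n → shift 𝟘 n ≡ + 0
  shift-𝟘 zero    = refl
  shift-𝟘 (suc n) = refl

-- Theta functions

Σ< : (ℕ → ℤ) → ℕ → ℤ
Σ< h zero    = + 0
Σ< h (suc B) = Σ< h B ℤ.+ h B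

Σ<-cong : ∀ {h h′} B → (∀ j → h j ≡ h′ j) → Σ< h B ≡ Σ< h′ B
Σ<-cong zero    h≡ = refl
Σ<-cong (suc B) h≡ = cong₂ ℤ._+_ (Σ<-cong B h≡) (h≡ B)

Σ<-zero : ∀ {h} B → (∀ j → h j ≡ + 0) → Σ< h B ≡ + 0
Σ<-zero zero    h≡0 = refl
Σ<-zero (suc B) h≡0 = cong₂ ℤ._+_ (Σ<-zero B h≡0) (h≡0 B)

Σ<-vanishing : ∀ {h B₀ B} → (∀ j → B₀ ≤ j → h j ≡ + 0) → B₀ ≤ B → Σ< h B ≡ Σ< h B₀
Σ<-vanishing {h} {B₀} h≡0 B₀≤B = subst (λ B → Σ< h B ≡ Σ< h B₀) (ℕₚ.m+[n∸m]≡n B₀≤B) (go (_ ∸ B₀))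
  where
  go : ∀ d → Σ< h (B₀ + d) ≡ Σ< h B₀
  go zero    = cong (Σ< h) (ℕₚ.+-identityʳ B₀)
  go (suc d) = trans (cong (Σ< h) (ℕₚ.+-suc B₀ d))
    (trans (cong₂ ℤ._+_ (go d) (h≡0 (B₀ + d) (ℕₚ.m≤m+n B₀ d))) (ℤₚ.+-identityʳ _))

Σ<-suc : ∀ h B → Σ< h (suc B) ≡ h 0 ℤ.+ Σ< (h ∘ suc) B
Σ<-suc h zero    = trans (ℤₚ.+-identityˡ (h 0)) (sym (ℤₚ.+-identityʳ (h 0)))
Σ<-suc h (suc B) = trans (cong (λ x → x ℤ.+ h (suc B)) (Σ<-suc h B)) (ℤₚ.+-assoc (h 0) _ _)

Σ<-double : ∀ h B → Σ< h (double B) ≡ Σ< (h ∘ double) B ℤ.+ Σ< (h ∘ suc ∘ double) B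
Σ<-double h zero    = refl
Σ<-double h (suc B) = trans (cong (λ x → x ℤ.+ h (double B) ℤ.+ h (suc (double B))) (Σ<-double h B))
  (trans (ℤₚ.+-assoc (Σ< (h ∘ double) B ℤ.+ Σ< (h ∘ suc ∘ double) B) (h (double B)) (h (suc (double B))))
         (ℤ+.interchange (Σ< (h ∘ double) B) (Σ< (h ∘ suc ∘ double) B) (h (double B)) (h (suc (double B)))))

Inflationary : (ℕ → ℕ) → Set
Inflationary e = ∀ j → j ≤ e j

-- Σⱼ q^(e j); inflationarity of e makes the terms j ≤ n the only ones reaching degree n.
monoSum : (ℕ → ℕ) → FPS
monoSum e n = Σ< (λ j → qpow (e j) n) (suc n)

module _ {e : ℕ → ℕ} (e-infl : Inflationary e) where

  monoSum-Σ< : ∀ {n B} → n < B → Σ< (λ j → qpow (e j) n) B ≡ monoSum e n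
  monoSum-Σ< n<B = Σ<-vanishing (λ j n<j → qpow-< (ℕₚ.<-≤-trans n<j (e-infl j))) n<B

  monoSum-parity : monoSum e ≈ monoSum (e ∘ double) ⊕ monoSum (e ∘ suc ∘ double)
  monoSum-parity = coeffwise λ n →
    trans (sym (monoSum-Σ< {B = double (suc n)} (s≤s (ℕₚ.m≤n⇒m≤1+n (n≤double n)))))
          (Σ<-double (λ j → qpow (e j) n) (suc n))

  monoSum-shift : monoSum (suc ∘ e) ≈ shift (monoSum e)
  monoSum-shift = coeffwise λ where
    zero    → Σ<-zero 1 (λ _ → refl)
    (suc n) → monoSum-Σ< {n = n} (ℕₚ.m≤n⇒m≤1+n (ℕₚ.n<1+n n))

monoSum-cong : ∀ {e e′} → (∀ j → e j ≡ e′ j) → monoSum e ≈ monoSum e′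
monoSum-cong e≡ = coeffwise λ n → Σ<-cong (suc n) (λ j → cong (λ x → qpow x n) (e≡ j))

monoSum-dilate : ∀ {g} → Inflationary g → monoSum (λ j → 2 * g j) ≈ dilate (monoSum g)
monoSum-dilate {g} g-infl = dilate-unique
  (coeffwise λ n → trans (Σ<-cong (suc (double n)) λ j →
                            trans (sym (coeff (dilate-qpow (g j)) (double n))) (dilate-double (qpow (g j)) n))
                         (monoSum-Σ< g-infl (s≤s (n≤double n))))
  (coeffwise λ n → Σ<-zero (suc (suc (double n))) λ j →
                     trans (sym (coeff (dilate-qpow (g j)) (suc (double n)))) (dilate-odd (qpow (g j)) n))

2*-inflationary : ∀ {g} → Inflationary g → Inflationary (λ j → 2 * g j)
2*-inflationary g-infl j = ℕₚ.≤-trans (g-infl j) (ℕₚ.m≤n*m _ 2)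

monoSum-odd : ∀ {g} → Inflationary g → monoSum (λ j → suc (2 * g j)) ≈ shift (dilate (monoSum g))
monoSum-odd g-infl = ≈-trans (monoSum-shift (2*-inflationary g-infl)) (shift-cong (monoSum-dilate g-infl))

θexp : ℕ → ℕ → ℕ → ℕ
θexp s t zero    = 0
θexp s t (suc i) = θexp s t i + s * suc i + t * i

-- Ramanujan's f(q^s, q^t) = Σₙ q^(s n(n+1)/2 + t n(n-1)/2) over n ∈ ℤ: the first sum runs over
-- n = i ≥ 0, the second over n = -(1 + i).
θ : ℕ → ℕ → FPS
θ s t = monoSum (θexp s t) ⊕ monoSum (θexp t s ∘ suc)

-- θexp s t i = s i(i+1)/2 + t i(i-1)/2, doubled to avoid division and truncated subtraction.
θexp-double : ∀ s t i → 2 * θexp s t i + 2 * t * i ≡ (s + t) * (i * suc i)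
θexp-double s t zero    = trans (ℕₚ.*-zeroʳ (2 * t)) (sym (ℕₚ.*-zeroʳ (s + t)))
θexp-double s t (suc i) = begin
  2 * (θexp s t i + s * suc i + t * i) + 2 * t * suc i       ≡⟨ rearrange (θexp s t i) s t i ⟩
  (2 * θexp s t i + 2 * t * i) + 2 * (s + t) * suc i
    ≡⟨ cong (λ x → x + 2 * (s + t) * suc i) (θexp-double s t i) ⟩
  (s + t) * (i * suc i) + 2 * (s + t) * suc i                 ≡⟨ complete s t i ⟩
  (s + t) * (suc i * suc (suc i))                             ∎
  where
  open ≡-Reasoning
  rearrange : ∀ x s t i → 2 * (x + s * suc i + t * i) + 2 * t * suc i ≡ (2 * x + 2 * t * i) + 2 * (s + t) * suc i
  rearrange = solve-∀
  complete : ∀ s t i → (s + t) * (i * suc i) + 2 * (s + t) * suc i ≡ (s + t) * (suc i * suc (suc i))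
  complete = solve-∀

θexp-char : ∀ s t i {y} → 2 * y + 2 * t * i ≡ (s + t) * (i * suc i) → θexp s t i ≡ y
θexp-char s t i {y} y-closed = ℕₚ.*-cancelˡ-≡ _ _ 2
  (ℕₚ.+-cancelʳ-≡ _ _ _ (trans (θexp-double s t i) (sym y-closed)))

θexp-≡ : ∀ {s t i s′ t′ i′} → (s + t) * (i * suc i) + 2 * t′ * i′ ≡ (s′ + t′) * (i′ * suc i′) + 2 * t * i →
         θexp s t i ≡ θexp s′ t′ i′
θexp-≡ {s} {t} {i} {s′} {t′} {i′} closed≡ = θexp-char s t i (ℕₚ.+-cancelʳ-≡ (2 * t′ * i′) _ _ (begin
  2 * y + 2 * t * i + 2 * t′ * i′      ≡⟨ ℕₚ.+-assoc (2 * y) _ _ ⟩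
  2 * y + (2 * t * i + 2 * t′ * i′)    ≡⟨ cong (_+_ (2 * y)) (ℕₚ.+-comm (2 * t * i) _) ⟩
  2 * y + (2 * t′ * i′ + 2 * t * i)    ≡⟨ ℕₚ.+-assoc (2 * y) _ _ ⟨
  2 * y + 2 * t′ * i′ + 2 * t * i      ≡⟨ cong (λ x → x + 2 * t * i) (θexp-double s′ t′ i′) ⟩
  (s′ + t′) * (i′ * suc i′) + 2 * t * i ≡⟨ closed≡ ⟨
  (s + t) * (i * suc i) + 2 * t′ * i′  ∎))
  where
  open ≡-Reasoning
  y = θexp s′ t′ i′

θexp-2* : ∀ s t i → θexp (2 * s) (2 * t) i ≡ 2 * θexp s t i
θexp-2* s t i = θexp-char (2 * s) (2 * t) i (trans (doubled (θexp s t i) s t i)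
  (trans (cong (_*_ 2) (θexp-double s t i)) (scaled s t i)))
  where
  doubled : ∀ x s t i → 2 * (2 * x) + 2 * (2 * t) * i ≡ 2 * (2 * x + 2 * t * i)
  doubled = solve-∀
  scaled : ∀ s t i → 2 * ((s + t) * (i * suc i)) ≡ (2 * s + 2 * t) * (i * suc i)
  scaled = solve-∀

θexp-inflationary : ∀ s t .{{_ : NonZero s}} → Inflationary (θexp s t)
θexp-inflationary s t zero    = z≤n
θexp-inflationary s t (suc i) = ℕₚ.≤-trans (s≤s (θexp-inflationary s t i))
  (ℕₚ.<-≤-trans (ℕₚ.m<m+n (θexp s t i) (ℕ.>-nonZero⁻¹ (s * suc i) {{ℕₚ.m*n≢0 s (suc i)}}))
                (ℕₚ.m≤m+n _ (t * i)))

θexp-suc-inflationary : ∀ s t .{{_ : NonZero s}} → Inflationary (θexp s t ∘ suc)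
θexp-suc-inflationary s t i = ℕₚ.≤-trans (ℕₚ.n≤1+n i) (θexp-inflationary s t (suc i))

θodd : ℕ → ℕ → ℕ → ℕ
θodd a b m = 2 * (m * suc m) + (2 * m + 1) * (suc m * a + m * b)

θodd-inflationary : ∀ a b → Inflationary (θodd a b)
θodd-inflationary a b m = ℕₚ.≤-trans (ℕₚ.m≤m*n m (suc m))
  (ℕₚ.≤-trans (ℕₚ.m≤n*m (m * suc m) 2) (ℕₚ.m≤m+n _ _))

θexp-even-index : ∀ a b m → θexp (1 + 2 * a) (1 + 2 * b) (double m) ≡ 2 * θexp (2 + 3 * a + b) (2 + 3 * b + a) m
θexp-even-index a b m = trans (cong (θexp (1 + 2 * a) (1 + 2 * b)) (double≡2* m))
  (trans (θexp-≡ {1 + 2 * a} {1 + 2 * b} {2 * m} {2 * (2 + 3 * a + b)} {2 * (2 + 3 * b + a)} {m} (closed-forms a b m))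
         (θexp-2* (2 + 3 * a + b) (2 + 3 * b + a) m))
  where
  closed-forms : ∀ a b m →
    (1 + 2 * a + (1 + 2 * b)) * (2 * m * suc (2 * m)) + 2 * (2 * (2 + 3 * b + a)) * m ≡
    (2 * (2 + 3 * a + b) + 2 * (2 + 3 * b + a)) * (m * suc m) + 2 * (1 + 2 * b) * (2 * m)
  closed-forms = solve-∀

θexp-odd-index : ∀ a b m → θexp (1 + 2 * a) (1 + 2 * b) (suc (double m)) ≡ suc (2 * θodd a b m)
θexp-odd-index a b m = trans (cong (θexp (1 + 2 * a) (1 + 2 * b) ∘ suc) (double≡2* m))
  (θexp-char (1 + 2 * a) (1 + 2 * b) (suc (2 * m)) (closed-form a b m))
  where
  closed-form : ∀ a b m →
    2 * suc (2 * (2 * (m * suc m) + (2 * m + 1) * (suc m * a + m * b))) + 2 * (1 + 2 * b) * suc (2 * m) ≡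
    (1 + 2 * a + (1 + 2 * b)) * (suc (2 * m) * suc (suc (2 * m)))
  closed-form = solve-∀

θ-dissection : ∀ a b → θ (1 + 2 * a) (1 + 2 * b) ≈
  dilate (θ (2 + 3 * a + b) (2 + 3 * b + a)) ⊕ shift (dilate (monoSum (θodd a b) ⊕ monoSum (θodd b a)))
θ-dissection a b = begin
  monoSum (θexp s t) ⊕ monoSum (θexp t s ∘ suc)
    ≈⟨ ⊕-cong (monoSum-parity (θexp-inflationary s t)) (monoSum-parity (θexp-suc-inflationary t s)) ⟩
  (monoSum (θexp s t ∘ double) ⊕ monoSum (θexp s t ∘ suc ∘ double)) ⊕
  (monoSum (θexp t s ∘ suc ∘ double) ⊕ monoSum (θexp t s ∘ double ∘ suc))
    ≈⟨ ⊕-cong (⊕-cong (monoSum-cong (θexp-even-index a b)) (monoSum-cong (θexp-odd-index a b)))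
              (⊕-cong (monoSum-cong (θexp-odd-index b a)) (monoSum-cong (θexp-even-index b a ∘ suc))) ⟩
  (monoSum (λ m → 2 * θexp S T m) ⊕ monoSum (λ m → suc (2 * θodd a b m))) ⊕
  (monoSum (λ m → suc (2 * θodd b a m)) ⊕ monoSum (λ m → 2 * θexp T S (suc m)))
    ≈⟨ ⊕-cong (⊕-cong (monoSum-dilate (θexp-inflationary S T)) (monoSum-odd (θodd-inflationary a b)))
              (⊕-cong (monoSum-odd (θodd-inflationary b a)) (monoSum-dilate (θexp-suc-inflationary T S))) ⟩
  (dilate (monoSum (θexp S T)) ⊕ shift (dilate (monoSum (θodd a b)))) ⊕
  (shift (dilate (monoSum (θodd b a))) ⊕ dilate (monoSum (θexp T S ∘ suc)))
    ≈⟨ ⊕-congˡ (dA ⊕ sB) (+-comm sC dD) ⟩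
  (dilate (monoSum (θexp S T)) ⊕ shift (dilate (monoSum (θodd a b)))) ⊕
  (dilate (monoSum (θexp T S ∘ suc)) ⊕ shift (dilate (monoSum (θodd b a))))
    ≈⟨ ⊕.interchange dA sB dD sC ⟩
  (dilate (monoSum (θexp S T)) ⊕ dilate (monoSum (θexp T S ∘ suc))) ⊕
  (shift (dilate (monoSum (θodd a b))) ⊕ shift (dilate (monoSum (θodd b a))))
    ≈⟨ ⊕-cong (≈-sym (dilate-⊕ _ _)) (≈-trans (≈-sym (shift-⊕ _ _)) (shift-cong (≈-sym (dilate-⊕ _ _)))) ⟩
  dilate (θ S T) ⊕ shift (dilate (monoSum (θodd a b) ⊕ monoSum (θodd b a)))
    ∎
  where
  open ≈-Reasoning
  s t S T : ℕ
  s = 1 + 2 * a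
  t = 1 + 2 * b
  S = 2 + 3 * a + b
  T = 2 + 3 * b + a
  dA sB sC dD : FPS
  dA = dilate (monoSum (θexp S T))
  sB = shift (dilate (monoSum (θodd a b)))
  sC = shift (dilate (monoSum (θodd b a)))
  dD = dilate (monoSum (θexp T S ∘ suc))

evenPart-θ : ∀ a b → evenPart (θ (1 + 2 * a) (1 + 2 * b)) ≈ θ (2 + 3 * a + b) (2 + 3 * b + a)
evenPart-θ a b = evenPart-unique (θ-dissection a b)

oddPart-θ : ∀ a b → oddPart (θ (1 + 2 * a) (1 + 2 * b)) ≈ monoSum (θodd a b) ⊕ monoSum (θodd b a)
oddPart-θ a b = oddPart-unique (θ-dissection a b)

monoSum-pronic : ∀ c .{{_ : NonZero c}} → monoSum (λ m → c * (m * suc m)) ≈ θ (6 * c) (2 * c)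
monoSum-pronic c = ≈-trans (monoSum-parity pronic-inflationary)
  (⊕-cong (monoSum-cong λ j → sym (θexp-char (6 * c) (2 * c) j (even-index c j)))
          (monoSum-cong λ j → sym (θexp-char (2 * c) (6 * c) (suc j) (odd-index c j))))
  where
  pronic-inflationary : Inflationary (λ m → c * (m * suc m))
  pronic-inflationary m = ℕₚ.≤-trans (ℕₚ.m≤m*n m (suc m)) (ℕₚ.m≤n*m (m * suc m) c)
  even-index : ∀ c j → 2 * (c * (double j * suc (double j))) + 2 * (2 * c) * j ≡ (6 * c + 2 * c) * (j * suc j)
  even-index c j = trans (cong (λ d → 2 * (c * (d * suc d)) + 2 * (2 * c) * j) (double≡2* j)) (poly c j)
    where
    poly : ∀ c j → 2 * (c * (2 * j * suc (2 * j))) + 2 * (2 * c) * j ≡ (6 * c + 2 * c) * (j * suc j)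
    poly = solve-∀
  odd-index : ∀ c j → 2 * (c * (suc (double j) * suc (suc (double j)))) + 2 * (6 * c) * suc j ≡
                      (2 * c + 6 * c) * (suc j * suc (suc j))
  odd-index c j = trans (cong (λ d → 2 * (c * (suc d * suc (suc d))) + 2 * (6 * c) * suc j) (double≡2* j)) (poly c j)
    where
    poly : ∀ c j → 2 * (c * (suc (2 * j) * suc (suc (2 * j)))) + 2 * (6 * c) * suc j ≡
                   (2 * c + 6 * c) * (suc j * suc (suc j))
    poly = solve-∀

dilate-θ : ∀ s t .{{_ : NonZero s}} .{{_ : NonZero t}} → dilate (θ s t) ≈ θ (2 * s) (2 * t)
dilate-θ s t = ≈-sym (begin
  monoSum (θexp (2 * s) (2 * t)) ⊕ monoSum (θexp (2 * t) (2 * s) ∘ suc)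
    ≈⟨ ⊕-cong (monoSum-cong (θexp-2* s t)) (monoSum-cong (θexp-2* t s ∘ suc)) ⟩
  monoSum (λ i → 2 * θexp s t i) ⊕ monoSum (λ i → 2 * θexp t s (suc i))
    ≈⟨ ⊕-cong (monoSum-dilate (θexp-inflationary s t)) (monoSum-dilate (θexp-suc-inflationary t s)) ⟩
  dilate (monoSum (θexp s t)) ⊕ dilate (monoSum (θexp t s ∘ suc))
    ≈⟨ dilate-⊕ _ _ ⟨
  dilate (θ s t) ∎)
  where open ≈-Reasoning

-- The Jacobi triple product

module Gaussian (c : ℕ) where

  x^ : ℕ → FPS
  x^ k = qpow (k * c)

  x^-+ : ∀ a b → x^ a ⊙ x^ b ≈ x^ (a + b)
  x^-+ a b = ≈-trans (qpow-+ (a * c) (b * c)) (≡⇒≈ (cong qpow (sym (ℕₚ.*-distribʳ-+ c a b))))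

  x^-swap : ∀ a b a′ b′ → a + b ≡ a′ + b′ → x^ a ⊙ x^ b ≈ x^ a′ ⊙ x^ b′
  x^-swap a b a′ b′ ab≡ = ≈-trans (x^-+ a b) (≈-trans (≡⇒≈ (cong x^ ab≡)) (≈-sym (x^-+ a′ b′)))

  -- gauss m n is the Gaussian binomial coefficient [m + n choose m] in x = q^c.
  gauss : ℕ → ℕ → FPS
  gauss zero    n       = one
  gauss (suc m) zero    = one
  gauss (suc m) (suc n) = gauss m (suc n) ⊕ x^ (suc m) ⊙ gauss (suc m) n

  private
    distribute : ∀ u g a b → u ⊕ a ⊙ (g ⊕ b ⊙ u) ≈ (u ⊕ a ⊙ g) ⊕ (a ⊙ b) ⊙ u
    distribute = solve 4 (λ u g a b → u :+ a :* (g :+ b :* u) := (u :+ a :* g) :+ (a :* b) :* u) ≈-refl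
      where open ⊙-Solver
    distribute₂ : ∀ A B C a b c → (A ⊕ c ⊙ B) ⊕ a ⊙ (C ⊕ b ⊙ A) ≈ ((A ⊕ a ⊙ C) ⊕ c ⊙ B) ⊕ (a ⊙ b) ⊙ A
    distribute₂ = solve 6 (λ A B C a b c → (A :+ c :* B) :+ a :* (C :+ b :* A)
                                         := ((A :+ a :* C) :+ c :* B) :+ (a :* b) :* A) ≈-refl
      where open ⊙-Solver
    distribute₃ : ∀ A B C a c d → (A ⊕ a ⊙ C) ⊕ c ⊙ (B ⊕ d ⊙ A) ≈ ((A ⊕ a ⊙ C) ⊕ c ⊙ B) ⊕ (c ⊙ d) ⊙ A
    distribute₃ = solve 6 (λ A B C a c d → (A :+ a :* C) :+ c :* (B :+ d :* A)
                                         := ((A :+ a :* C) :+ c :* B) :+ (c :* d) :* A) ≈-refl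
      where open ⊙-Solver

  gauss-pascal : ∀ m n → gauss (suc m) (suc n) ≈ gauss (suc m) n ⊕ x^ (suc n) ⊙ gauss m (suc n)
  gauss-pascal zero n = row n
    where
    open ≈-Reasoning
    row : ∀ n → gauss 1 (suc n) ≈ gauss 1 n ⊕ x^ (suc n) ⊙ one
    row zero    = ≈-refl
    row (suc n) = begin
      one ⊕ x^ 1 ⊙ gauss 1 (suc n)                          ≈⟨ ⊕-congˡ one (⊙-congˡ (x^ 1) (row n)) ⟩
      one ⊕ x^ 1 ⊙ (gauss 1 n ⊕ x^ (suc n) ⊙ one)           ≈⟨ distribute one (gauss 1 n) (x^ 1) (x^ (suc n)) ⟩
      (one ⊕ x^ 1 ⊙ gauss 1 n) ⊕ (x^ 1 ⊙ x^ (suc n)) ⊙ one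
        ≈⟨ ⊕-congˡ (one ⊕ x^ 1 ⊙ gauss 1 n) (⊙-congʳ one (x^-+ 1 (suc n))) ⟩
      (one ⊕ x^ 1 ⊙ gauss 1 n) ⊕ x^ (2 + n) ⊙ one           ∎
  gauss-pascal (suc m) zero = column (suc m)
    where
    open ≈-Reasoning
    column : ∀ m → gauss (suc m) 1 ≈ one ⊕ x^ 1 ⊙ gauss m 1
    column zero    = ≈-refl
    column (suc m) = begin
      gauss (suc m) 1 ⊕ x^ (2 + m) ⊙ one                    ≈⟨ ⊕-congʳ (x^ (2 + m) ⊙ one) (column m) ⟩
      (one ⊕ x^ 1 ⊙ gauss m 1) ⊕ x^ (2 + m) ⊙ one
        ≈⟨ ⊕-congˡ (one ⊕ x^ 1 ⊙ gauss m 1) (⊙-congʳ one (x^-+ 1 (suc m))) ⟨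
      (one ⊕ x^ 1 ⊙ gauss m 1) ⊕ (x^ 1 ⊙ x^ (suc m)) ⊙ one  ≈⟨ distribute one (gauss m 1) (x^ 1) (x^ (suc m)) ⟨
      one ⊕ x^ 1 ⊙ (gauss m 1 ⊕ x^ (suc m) ⊙ one)           ∎
  gauss-pascal (suc m) (suc n) = begin
    gauss (suc m) (2 + n) ⊕ x^ (2 + m) ⊙ gauss (2 + m) (suc n)
      ≈⟨ ⊕-cong (gauss-pascal m (suc n)) (⊙-congˡ (x^ (2 + m)) (gauss-pascal (suc m) n)) ⟩
    (A ⊕ x^ (2 + n) ⊙ B) ⊕ x^ (2 + m) ⊙ (C ⊕ x^ (suc n) ⊙ A)
      ≈⟨ distribute₂ A B C (x^ (2 + m)) (x^ (suc n)) (x^ (2 + n)) ⟩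
    ((A ⊕ x^ (2 + m) ⊙ C) ⊕ x^ (2 + n) ⊙ B) ⊕ (x^ (2 + m) ⊙ x^ (suc n)) ⊙ A
      ≈⟨ ⊕-congˡ ((A ⊕ x^ (2 + m) ⊙ C) ⊕ x^ (2 + n) ⊙ B) (⊙-congʳ A (x^-swap (2 + m) (suc n) (2 + n) (suc m) (exponents m n))) ⟩
    ((A ⊕ x^ (2 + m) ⊙ C) ⊕ x^ (2 + n) ⊙ B) ⊕ (x^ (2 + n) ⊙ x^ (suc m)) ⊙ A
      ≈⟨ distribute₃ A B C (x^ (2 + m)) (x^ (2 + n)) (x^ (suc m)) ⟨
    (A ⊕ x^ (2 + m) ⊙ C) ⊕ x^ (2 + n) ⊙ (B ⊕ x^ (suc m) ⊙ A)
      ∎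
    where
    open ≈-Reasoning
    A B C : FPS
    A = gauss (suc m) (suc n)
    B = gauss m (2 + n)
    C = gauss (2 + m) n
    exponents : ∀ m n → 2 + m + suc n ≡ 2 + n + suc m
    exponents = solve-∀

  xPoch : ℕ → FPS
  xPoch = ∏< (λ j → 1-q^ (suc j * c))

  private
    regroup : ∀ G₁ G₂ Eₘ Eₙ a α β → (G₁ ⊕ a ⊙ G₂) ⊙ ((Eₘ ⊙ α) ⊙ (Eₙ ⊙ β)) ≈
              (G₁ ⊙ (Eₘ ⊙ (Eₙ ⊙ β))) ⊙ α ⊕ a ⊙ ((G₂ ⊙ ((Eₘ ⊙ α) ⊙ Eₙ)) ⊙ β)
    regroup = solve 7 (λ G₁ G₂ Eₘ Eₙ a α β → (G₁ :+ a :* G₂) :* ((Eₘ :* α) :* (Eₙ :* β))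
      := (G₁ :* (Eₘ :* (Eₙ :* β))) :* α :+ a :* ((G₂ :* ((Eₘ :* α) :* Eₙ)) :* β)) ≈-refl
      where open ⊙-Solver
    telescope : ∀ U a b → U ⊙ (one ⊕ ⊝ a) ⊕ a ⊙ (U ⊙ (one ⊕ ⊝ b)) ≈ U ⊙ (one ⊕ ⊝ (a ⊙ b))
    telescope U a b = begin
      U ⊙ (one ⊕ ⊝ a) ⊕ a ⊙ (U ⊙ (one ⊕ ⊝ b))
        ≈⟨ ⊕-cong (⊙-congˡ U (1-minus a)) (⊙-congˡ a (⊙-congˡ U (1-minus b))) ⟩
      U ⊙ (const (+ 1) ⊕ ⊝ a) ⊕ a ⊙ (U ⊙ (const (+ 1) ⊕ ⊝ b))
        ≈⟨ solve 3 (λ U a b → U :* (con (+ 1) :- a) :+ a :* (U :* (con (+ 1) :- b)) := U :* (con (+ 1) :- a :* b)) ≈-refl U a b ⟩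
      U ⊙ (const (+ 1) ⊕ ⊝ (a ⊙ b))
        ≈⟨ ⊙-congˡ U (1-minus (a ⊙ b)) ⟨
      U ⊙ (one ⊕ ⊝ (a ⊙ b)) ∎
      where
      open ≈-Reasoning
      open ⊙-Solver
      1-minus : ∀ y → one ⊕ ⊝ y ≈ const (+ 1) ⊕ ⊝ y
      1-minus y = ⊕-congʳ (⊝ y) one≈const

  gauss-xPoch : ∀ m n → gauss m n ⊙ (xPoch m ⊙ xPoch n) ≈ xPoch (m + n)
  gauss-xPoch zero    n       = ≈-trans (⊙-identityˡ _) (⊙-identityˡ _)
  gauss-xPoch (suc m) zero    = ≈-trans (⊙-identityˡ _)
    (≈-trans (*-identityʳ _) (≡⇒≈ (cong xPoch (sym (ℕₚ.+-identityʳ (suc m))))))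
  gauss-xPoch (suc m) (suc n) = begin
    (G₁ ⊕ xa ⊙ G₂) ⊙ ((xPoch m ⊙ α) ⊙ (xPoch n ⊙ β))
      ≈⟨ regroup G₁ G₂ (xPoch m) (xPoch n) xa α β ⟩
    (G₁ ⊙ (xPoch m ⊙ (xPoch n ⊙ β))) ⊙ α ⊕ xa ⊙ ((G₂ ⊙ ((xPoch m ⊙ α) ⊙ xPoch n)) ⊙ β)
      ≈⟨ ⊕-cong (⊙-congʳ α (gauss-xPoch m (suc n))) (⊙-congˡ xa (⊙-congʳ β (gauss-xPoch (suc m) n))) ⟩
    xPoch (m + suc n) ⊙ α ⊕ xa ⊙ (xPoch (suc (m + n)) ⊙ β)
      ≈⟨ ⊕-congˡ (xPoch (m + suc n) ⊙ α) (⊙-congˡ xa (⊙-congʳ β (≡⇒≈ (cong xPoch (ℕₚ.+-suc m n))))) ⟨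
    xPoch (m + suc n) ⊙ α ⊕ xa ⊙ (xPoch (m + suc n) ⊙ β)
      ≈⟨ telescope (xPoch (m + suc n)) xa xb ⟩
    xPoch (m + suc n) ⊙ (one ⊕ ⊝ (xa ⊙ xb))
      ≈⟨ ⊙-congˡ (xPoch (m + suc n)) (⊕-congˡ one (⊝-cong (x^-+ (suc m) (suc n)))) ⟩
    xPoch (suc m + suc n) ∎
    where
    open ≈-Reasoning
    G₁ G₂ xa xb α β : FPS
    G₁ = gauss m (suc n)
    G₂ = gauss (suc m) n
    xa = x^ (suc m)
    xb = x^ (suc n)
    α = 1-q^ (suc m * c)
    β = 1-q^ (suc n * c)

diag : (ℕ → ℕ → FPS) → ℕ → FPS
diag F zero    = F 0 0
diag F (suc L) = F 0 (suc L) ⊕ diag (λ i k → F (suc i) k) L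

diag-cong : ∀ {F F′} L → (∀ i k → i + k ≡ L → F i k ≈ F′ i k) → diag F L ≈ diag F′ L
diag-cong zero    F≈ = F≈ 0 0 refl
diag-cong (suc L) F≈ = ⊕-cong (F≈ 0 (suc L) refl) (diag-cong L λ i k i+k≡L → F≈ (suc i) k (cong suc i+k≡L))

diag-cong[] : ∀ {F F′ D} L → (∀ i k → i + k ≡ L → F i k ≈[ D ] F′ i k) → diag F L ≈[ D ] diag F′ L
diag-cong[] zero    F≈ = F≈ 0 0 refl
diag-cong[] (suc L) F≈ = ⊕-cong[] (F≈ 0 (suc L) refl) (diag-cong[] L λ i k i+k≡L → F≈ (suc i) k (cong suc i+k≡L))

diag-⊕ : ∀ F F′ L → diag (λ i k → F i k ⊕ F′ i k) L ≈ diag F L ⊕ diag F′ L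
diag-⊕ F F′ zero    = ≈-refl
diag-⊕ F F′ (suc L) = ≈-trans (⊕-congˡ (F 0 (suc L) ⊕ F′ 0 (suc L)) (diag-⊕ (λ i → F (suc i)) (λ i → F′ (suc i)) L))
  (⊕.interchange (F 0 (suc L)) (F′ 0 (suc L)) (diag (λ i → F (suc i)) L) (diag (λ i → F′ (suc i)) L))

diag-⊙ : ∀ y F L → diag (λ i k → y ⊙ F i k) L ≈ y ⊙ diag F L
diag-⊙ y F zero    = ≈-refl
diag-⊙ y F (suc L) = ≈-trans (⊕-congˡ (y ⊙ F 0 (suc L)) (diag-⊙ y (λ i → F (suc i)) L))
  (≈-sym (⊙-distribˡ y (F 0 (suc L)) (diag (λ i → F (suc i)) L)))

diag-snoc : ∀ F L → diag F (suc L) ≈ diag (λ i k → F i (suc k)) L ⊕ F (suc L) 0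
diag-snoc F zero    = ≈-refl
diag-snoc F (suc L) = ≈-trans (⊕-congˡ (F 0 (2 + L)) (diag-snoc (λ i → F (suc i)) L))
  (≈-sym (+-assoc (F 0 (2 + L)) (diag (λ i k → F (suc i) (suc k)) L) (F (2 + L) 0)))

-- The diagonal analogue of Pascal's rule.
diag-split : ∀ {Q A B} → (∀ k → Q 0 (suc k) ≈ A 0 k) → (∀ i → Q (suc i) 0 ≈ B i 0) →
             (∀ i k → Q (suc i) (suc k) ≈ A (suc i) k ⊕ B i (suc k)) → ∀ L → diag Q (suc L) ≈ diag A L ⊕ diag B L
diag-split Q₀ₖ Qᵢ₀ Qᵢₖ zero    = ⊕-cong (Q₀ₖ 0) (Qᵢ₀ 0)
diag-split {Q} {A} {B} Q₀ₖ Qᵢ₀ Qᵢₖ (suc L) = begin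
  Q 0 (2 + L) ⊕ diag (λ i → Q (suc i)) (suc L)
    ≈⟨ ⊕-cong (Q₀ₖ (suc L)) (diag-snoc (λ i → Q (suc i)) L) ⟩
  A 0 (suc L) ⊕ (diag (λ i k → Q (suc i) (suc k)) L ⊕ Q (2 + L) 0)
    ≈⟨ ⊕-congˡ (A 0 (suc L)) (⊕-cong (diag-cong L λ i k _ → Qᵢₖ i k) (Qᵢ₀ (suc L))) ⟩
  A 0 (suc L) ⊕ (diag (λ i k → A (suc i) k ⊕ B i (suc k)) L ⊕ B (suc L) 0)
    ≈⟨ ⊕-congˡ (A 0 (suc L)) (⊕-congʳ (B (suc L) 0) (diag-⊕ (λ i → A (suc i)) (λ i k → B i (suc k)) L)) ⟩
  A 0 (suc L) ⊕ ((diag (λ i → A (suc i)) L ⊕ diag (λ i k → B i (suc k)) L) ⊕ B (suc L) 0)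
    ≈⟨ ⊕-congˡ (A 0 (suc L)) (+-assoc (diag (λ i → A (suc i)) L) _ _) ⟩
  A 0 (suc L) ⊕ (diag (λ i → A (suc i)) L ⊕ (diag (λ i k → B i (suc k)) L ⊕ B (suc L) 0))
    ≈⟨ +-assoc (A 0 (suc L)) _ _ ⟨
  diag A (suc L) ⊕ (diag (λ i k → B i (suc k)) L ⊕ B (suc L) 0)
    ≈⟨ ⊕-congˡ (diag A (suc L)) (diag-snoc B L) ⟨
  diag A (suc L) ⊕ diag B (suc L) ∎
  where open ≈-Reasoning

seriesSum : (ℕ → FPS) → ℕ → FPS
seriesSum H B n = Σ< (λ j → H j n) B

diag-const : ∀ H L → diag (λ i k → H i) L ≈ seriesSum H (suc L)
diag-const H zero    = coeffwise λ n → sym (ℤₚ.+-identityˡ (H 0 n))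
diag-const H (suc L) = ≈-trans (⊕-congˡ (H 0) (diag-const (H ∘ suc) L))
  (coeffwise λ n → sym (Σ<-suc (λ j → H j n) (suc L)))

monoSum≈[]seriesSum : ∀ {e} → Inflationary e → ∀ {D B} → (∀ j → B ≤ j → D < e j) →
                      monoSum e ≈[ D ] seriesSum (qpow ∘ e) B
monoSum≈[]seriesSum {e} e-infl {D} {B} large = agreeUpTo λ n n≤D → trans
  (sym (monoSum-Σ< e-infl {B = B + suc n} (ℕₚ.m≤n+m (suc n) B)))
  (Σ<-vanishing (λ j B≤j → qpow-< (ℕₚ.≤-<-trans n≤D (large j B≤j))) (ℕₚ.m≤m+n B (suc n)))

module FiniteJacobiTriple (s t : ℕ) where

  open Gaussian (s + t)

  c : ℕ
  c = s + t

  -- The exponent of q in θ s t for the index n = i - M.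
  jexp : ℕ → ℕ → ℕ
  jexp i       zero    = θexp s t i
  jexp zero    (suc M) = θexp t s (suc M)
  jexp (suc i) (suc M) = jexp i M

  jexp-zero : ∀ M → jexp 0 M ≡ θexp t s M
  jexp-zero zero    = refl
  jexp-zero (suc M) = refl

  jexp-stepˡ : ∀ M N i k → i + k ≡ N + M → s + N * c + jexp i M ≡ k * c + jexp (suc i) M
  jexp-stepˡ zero N i k i+k≡N = trans (cong (λ n → s + n * c + θexp s t i) (sym (trans i+k≡N (ℕₚ.+-identityʳ N))))
    (poly s t i k (θexp s t i))
    where
    poly : ∀ s t i k x → s + (i + k) * (s + t) + x ≡ k * (s + t) + (x + s * suc i + t * i)
    poly = solve-∀
  jexp-stepˡ (suc M) N zero k k≡N+1+M = trans (poly s t N M (θexp t s M))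
    (cong₂ (λ n x → n * c + x) (sym k≡N+1+M) (sym (jexp-zero M)))
    where
    poly : ∀ s t N M x → s + N * (s + t) + (x + t * suc M + s * M) ≡ (N + suc M) * (s + t) + x
    poly = solve-∀
  jexp-stepˡ (suc M) N (suc i) k i+k≡ = jexp-stepˡ M N i k (ℕₚ.suc-injective (trans i+k≡ (ℕₚ.+-suc N M)))

  jexp-stepʳ : ∀ M i → t + M * c + jexp i M ≡ i * c + jexp i (suc M)
  jexp-stepʳ zero    zero    = poly s t
    where
    poly : ∀ s t → t + 0 * (s + t) + 0 ≡ 0 * (s + t) + (0 + t * 1 + s * 0)
    poly = solve-∀
  jexp-stepʳ zero    (suc i) = poly s t i (θexp s t i)
    where
    poly : ∀ s t i x → t + 0 * (s + t) + (x + s * suc i + t * i) ≡ suc i * (s + t) + x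
    poly = solve-∀
  jexp-stepʳ (suc M) zero    = poly s t M (θexp t s (suc M))
    where
    poly : ∀ s t M x → t + suc M * (s + t) + x ≡ 0 * (s + t) + (x + t * suc (suc M) + s * suc M)
    poly = solve-∀
  jexp-stepʳ (suc M) (suc i) = trans (poly c t M (jexp i M))
    (trans (cong (_+_ c) (jexp-stepʳ M i)) (sym (ℕₚ.+-assoc c (i * c) _)))
    where
    poly : ∀ c t M x → t + suc M * c + x ≡ c + (t + M * c + x)
    poly = solve-∀

  private

    ⊙-1+q^ : ∀ X e → X ⊙ 1+q^ e ≈ X ⊕ qpow e ⊙ X
    ⊙-1+q^ X e = ≈-trans (⊙-distribˡ X one (qpow e)) (⊕-cong (*-identityʳ X) (⊙-comm X (qpow e)))

    distrib-shuffle : ∀ a x b w → (a ⊕ x ⊙ b) ⊙ w ≈ a ⊙ w ⊕ x ⊙ (b ⊙ w)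
    distrib-shuffle a x b w = ≈-trans (⊙-distribʳ w a (x ⊙ b)) (⊕-congˡ (a ⊙ w) (⊙-assoc x b w))

    qpow-jexpˡ : ∀ M N i k → i + k ≡ N + M → qpow (s + N * c) ⊙ qpow (jexp i M) ≈ x^ k ⊙ qpow (jexp (suc i) M)
    qpow-jexpˡ M N i k i+k≡ = ≈-trans (qpow-+ _ _)
      (≈-trans (≡⇒≈ (cong qpow (jexp-stepˡ M N i k i+k≡))) (≈-sym (qpow-+ _ _)))

    qpow-jexpʳ : ∀ M i → qpow (t + M * c) ⊙ qpow (jexp i M) ≈ x^ i ⊙ qpow (jexp i (suc M))
    qpow-jexpʳ M i = ≈-trans (qpow-+ _ _)
      (≈-trans (≡⇒≈ (cong qpow (jexp-stepʳ M i))) (≈-sym (qpow-+ _ _)))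

    gauss-zeroʳ : ∀ i → gauss i 0 ≈ one
    gauss-zeroʳ zero    = ≈-refl
    gauss-zeroʳ (suc i) = ≈-refl

  term : ℕ → ℕ → ℕ → FPS
  term M i k = gauss i k ⊙ qpow (jexp i M)

  Fₛ Fₜ : ℕ → FPS
  Fₛ k = 1+q^ (s + k * c)
  Fₜ k = 1+q^ (t + k * c)

  finiteJT : ∀ M N → ∏< Fₛ N ⊙ ∏< Fₜ M ≈ diag (term M) (N + M)
  finiteJT zero    zero    = ≈-refl
  finiteJT (suc M) zero    = begin
    one ⊙ (∏< Fₜ M ⊙ Fₜ M)                                ≈⟨ ⊙-assoc one (∏< Fₜ M) (Fₜ M) ⟨
    (one ⊙ ∏< Fₜ M) ⊙ Fₜ M                                ≈⟨ ⊙-congʳ (Fₜ M) (finiteJT M 0) ⟩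
    diag (term M) M ⊙ Fₜ M                                ≈⟨ ⊙-1+q^ (diag (term M) M) (t + M * c) ⟩
    diag (term M) M ⊕ qpow (t + M * c) ⊙ diag (term M) M  ≈⟨ ⊕-congˡ (diag (term M) M) (diag-⊙ _ (term M) M) ⟨
    diag (term M) M ⊕ diag (λ i k → qpow (t + M * c) ⊙ term M i k) M
      ≈⟨ ⊕-congˡ (diag (term M) M) (diag-cong M λ i k _ → shift-exponent i k) ⟩
    diag (term M) M ⊕ diag B M                            ≈⟨ +-comm (diag (term M) M) (diag B M) ⟩
    diag B M ⊕ diag (term M) M                            ≈⟨ diag-split {term (suc M)} {B} {term M} Q₀ₖ Qᵢ₀ Qᵢₖ M ⟨
    diag (term (suc M)) (suc M)                           ∎
    where
    open ≈-Reasoning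
    B : ℕ → ℕ → FPS
    B i k = x^ i ⊙ term (suc M) i k
    shift-exponent : ∀ i k → qpow (t + M * c) ⊙ term M i k ≈ B i k
    shift-exponent i k = ≈-trans (⊙.x∙yz≈y∙xz (qpow (t + M * c)) (gauss i k) _)
      (≈-trans (⊙-congˡ (gauss i k) (qpow-jexpʳ M i)) (⊙.x∙yz≈y∙xz (gauss i k) (x^ i) _))
    Q₀ₖ : ∀ k → term (suc M) 0 (suc k) ≈ B 0 k
    Q₀ₖ k = ≈-sym (⊙-identityˡ _)
    Qᵢ₀ : ∀ i → term (suc M) (suc i) 0 ≈ term M i 0
    Qᵢ₀ i = ⊙-congʳ (qpow (jexp i M)) (≈-sym (gauss-zeroʳ i))
    Qᵢₖ : ∀ i k → term (suc M) (suc i) (suc k) ≈ B (suc i) k ⊕ term M i (suc k)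
    Qᵢₖ i k = ≈-trans (distrib-shuffle (gauss i (suc k)) (x^ (suc i)) (gauss (suc i) k) (qpow (jexp i M)))
      (+-comm (gauss i (suc k) ⊙ qpow (jexp i M)) _)
  finiteJT M (suc N) = begin
    (∏< Fₛ N ⊙ Fₛ N) ⊙ ∏< Fₜ M                            ≈⟨ ⊙.xy∙z≈xz∙y (∏< Fₛ N) (Fₛ N) (∏< Fₜ M) ⟩
    (∏< Fₛ N ⊙ ∏< Fₜ M) ⊙ Fₛ N                            ≈⟨ ⊙-congʳ (Fₛ N) (finiteJT M N) ⟩
    diag (term M) L ⊙ Fₛ N                                ≈⟨ ⊙-1+q^ (diag (term M) L) (s + N * c) ⟩
    diag (term M) L ⊕ qpow (s + N * c) ⊙ diag (term M) L  ≈⟨ ⊕-congˡ (diag (term M) L) (diag-⊙ _ (term M) L) ⟨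
    diag (term M) L ⊕ diag (λ i k → qpow (s + N * c) ⊙ term M i k) L
      ≈⟨ ⊕-congˡ (diag (term M) L) (diag-cong L shift-exponent) ⟩
    diag (term M) L ⊕ diag B L                            ≈⟨ diag-split {term M} {term M} {B} Q₀ₖ Qᵢ₀ Qᵢₖ L ⟨
    diag (term M) (suc L)                                 ∎
    where
    open ≈-Reasoning
    L = N + M
    B : ℕ → ℕ → FPS
    B i k = x^ k ⊙ (gauss i k ⊙ qpow (jexp (suc i) M))
    shift-exponent : ∀ i k → i + k ≡ L → qpow (s + N * c) ⊙ term M i k ≈ B i k
    shift-exponent i k i+k≡L = ≈-trans (⊙.x∙yz≈y∙xz (qpow (s + N * c)) (gauss i k) _)
      (≈-trans (⊙-congˡ (gauss i k) (qpow-jexpˡ M N i k i+k≡L)) (⊙.x∙yz≈y∙xz (gauss i k) (x^ k) _))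
    Q₀ₖ : ∀ k → term M 0 (suc k) ≈ term M 0 k
    Q₀ₖ k = ≈-refl
    Qᵢ₀ : ∀ i → term M (suc i) 0 ≈ B i 0
    Qᵢ₀ i = ≈-sym (≈-trans (⊙-identityˡ _) (⊙-congʳ (qpow (jexp (suc i) M)) (gauss-zeroʳ i)))
    Qᵢₖ : ∀ i k → term M (suc i) (suc k) ≈ term M (suc i) k ⊕ B i (suc k)
    Qᵢₖ i k = ≈-trans (⊙-congʳ (qpow (jexp (suc i) M)) (gauss-pascal i k))
      (distrib-shuffle (gauss (suc i) k) (x^ (suc k)) (gauss i (suc k)) (qpow (jexp (suc i) M)))

module _ (c : ℕ) .{{_ : NonZero c}} where

  open Gaussian c

  xPoch≈[]f : ∀ {D m} → D ≤ m → xPoch m ≈[ D ] f c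
  xPoch≈[]f D≤m = ≈[]-sym (≈[]-trans (≈⇒≈[] _ (f≈qPoch c)) (∏∞-approx (qPoch-factors→1 c c) D≤m))

  f⊙gauss≈[]one : ∀ {D i k} → D ≤ i → D ≤ k → f c ⊙ gauss i k ≈[ D ] one
  f⊙gauss≈[]one {D} {i} {k} D≤i D≤k = ⊙-cancelʳ[] {f c} refl (begin
    (f c ⊙ gauss i k) ⊙ f c          ≈⟨ ≈⇒≈[] D (⊙.xy∙z≈y∙xz (f c) (gauss i k) (f c)) ⟩
    gauss i k ⊙ (f c ⊙ f c)          ≈⟨ ⊙-congˡ[] (gauss i k) (⊙-cong[] (xPoch≈[]f D≤i) (xPoch≈[]f D≤k)) ⟨
    gauss i k ⊙ (xPoch i ⊙ xPoch k)  ≈⟨ ≈⇒≈[] D (gauss-xPoch i k) ⟩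
    xPoch (i + k)                    ≈⟨ xPoch≈[]f (ℕₚ.≤-trans D≤i (ℕₚ.m≤m+n i k)) ⟩
    f c                              ≈⟨ ≈⇒≈[] D (⊙-identityˡ (f c)) ⟨
    one ⊙ f c                        ∎)
    where
    open ≈[]-Reasoning D

module _ (s t : ℕ) .{{_ : NonZero s}} .{{_ : NonZero t}} where

  open FiniteJacobiTriple s t
  open Gaussian c

  private
    instance
      c-nonZero : NonZero c
      c-nonZero = ℕ.>-nonZero (ℕₚ.<-≤-trans (ℕ.>-nonZero⁻¹ s) (ℕₚ.m≤m+n s t))

  jexp-distance : ∀ i M → ∣ i - M ∣ ≤ jexp i M
  jexp-distance i       zero    = subst (_≤ θexp s t i) (sym (ℕₚ.∣-∣-identityʳ i)) (θexp-inflationary s t i)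
  jexp-distance zero    (suc M) = θexp-inflationary t s (suc M)
  jexp-distance (suc i) (suc M) = jexp-distance i M

  diag-θ-exponents : ∀ M N → diag (λ i k → qpow (jexp i M)) (M + N) ≈
                   seriesSum (qpow ∘ θexp t s ∘ suc) M ⊕ seriesSum (qpow ∘ θexp s t) (suc N)
  diag-θ-exponents zero    N = ≈-trans (diag-const (qpow ∘ θexp s t) N) (≈-sym (+-identityˡ _))
  diag-θ-exponents (suc M) N = begin
    q ⊕ diag (λ i k → qpow (jexp i M)) (M + N)  ≈⟨ ⊕-congˡ q (diag-θ-exponents M N) ⟩
    q ⊕ (Σ⁻ ⊕ Σ⁺)                                 ≈⟨ +-assoc q Σ⁻ Σ⁺ ⟨
    (q ⊕ Σ⁻) ⊕ Σ⁺                                 ≈⟨ ⊕-congʳ Σ⁺ (+-comm q Σ⁻) ⟩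
    (Σ⁻ ⊕ q) ⊕ Σ⁺                                 ∎
    where
    open ≈-Reasoning
    q Σ⁻ Σ⁺ : FPS
    q = qpow (θexp t s (suc M))
    Σ⁻ = seriesSum (qpow ∘ θexp t s ∘ suc) M
    Σ⁺ = seriesSum (qpow ∘ θexp s t) (suc N)

  private
    far : ∀ {D j} → j ≤ D → D < ∣ j - suc (D + D) ∣
    far {D} {j} j≤D = ℕₚ.+-cancelˡ-< D D _ (ℕₚ.≤-trans
      (subst (λ d → suc (D + D) ≤ j + d) (ℕₚ.∣-∣-comm (suc (D + D)) j) (ℕₚ.m≤n+∣m-n∣ (suc (D + D)) j))
      (ℕₚ.+-monoˡ-≤ _ j≤D))

    mirror : ∀ {i k N} → i + k ≡ N + N → ∣ i - N ∣ ≡ ∣ k - N ∣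
    mirror {i} {k} {N} i+k≡ = begin
      ∣ i - N ∣             ≡⟨ ℕₚ.∣m+n-m+o∣≡∣n-o∣ k i N ⟨
      ∣ k + i - k + N ∣     ≡⟨ cong₂ ∣_-_∣ (trans (ℕₚ.+-comm k i) i+k≡) (ℕₚ.+-comm k N) ⟩
      ∣ N + N - N + k ∣     ≡⟨ ℕₚ.∣m+n-m+o∣≡∣n-o∣ N N k ⟩
      ∣ N - k ∣             ≡⟨ ℕₚ.∣-∣-comm N k ⟩
      ∣ k - N ∣             ∎
      where open ≡-Reasoning

    negligible : ∀ {D e} X → D < e → qpow e ≈[ D ] X ⊙ qpow e
    negligible {D} {e} X D<e = begin
      qpow e       ≈⟨ qpow-≈[]𝟘 D<e ⟩
      𝟘            ≈⟨ ≈⇒≈[] D (zeroʳ X) ⟨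
      X ⊙ 𝟘        ≈⟨ ⊙-congˡ[] X (qpow-≈[]𝟘 D<e) ⟨
      X ⊙ qpow e   ∎
      where
      open ≈[]-Reasoning D

    term≈[] : ∀ D i k → i + k ≡ suc (D + D) + suc (D + D) →
              qpow (jexp i (suc (D + D))) ≈[ D ] (f c ⊙ gauss i k) ⊙ qpow (jexp i (suc (D + D)))
    term≈[] D i k i+k≡ with D ≤? i | D ≤? k
    ... | yes D≤i | yes D≤k = ≈[]-sym (≈[]-trans
          (⊙-congʳ[] (qpow (jexp i (suc (D + D)))) (f⊙gauss≈[]one c D≤i D≤k)) (≈⇒≈[] D (⊙-identityˡ _)))
    ... | no D≰i | _      = negligible _ (ℕₚ.<-≤-trans (far (ℕₚ.<⇒≤ (ℕₚ.≰⇒> D≰i))) (jexp-distance i (suc (D + D))))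
    ... | yes _  | no D≰k = negligible _ (ℕₚ.<-≤-trans (subst (D <_) (sym (mirror {i} {k} i+k≡)) (far (ℕₚ.<⇒≤ (ℕₚ.≰⇒> D≰k))))
                                                         (jexp-distance i (suc (D + D))))

  -- Up to degree D, with N = 2D + 1: f c ⊙ gauss i k is 1 when i, k ≥ D, and otherwise the
  -- exponent of the term i of the finite product formula exceeds D.
  jacobiTriple≈[] : ∀ D → θ s t ≈[ D ] f c ⊙ (qPoch⁺ s c ⊙ qPoch⁺ t c)
  jacobiTriple≈[] D = begin
    θ s t
      ≈⟨ ⊕-cong[] (monoSum≈[]seriesSum (θexp-inflationary s t) large⁺)
                  (monoSum≈[]seriesSum (θexp-suc-inflationary t s) large⁻) ⟩
    seriesSum (qpow ∘ θexp s t) (suc N) ⊕ seriesSum (qpow ∘ θexp t s ∘ suc) N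
      ≈⟨ ≈⇒≈[] D (≈-trans (+-comm (seriesSum (qpow ∘ θexp s t) (suc N)) _) (≈-sym (diag-θ-exponents N N))) ⟩
    diag (λ i k → qpow (jexp i N)) (N + N)
      ≈⟨ diag-cong[] (N + N) (term≈[] D) ⟩
    diag (λ i k → (f c ⊙ gauss i k) ⊙ qpow (jexp i N)) (N + N)
      ≈⟨ ≈⇒≈[] D (≈-trans (diag-cong (N + N) λ i k _ → ⊙-assoc (f c) (gauss i k) (qpow (jexp i N)))
                          (diag-⊙ (f c) (term N) (N + N))) ⟩
    f c ⊙ diag (term N) (N + N)
      ≈⟨ ≈⇒≈[] D (⊙-congˡ (f c) (finiteJT N N)) ⟨
    f c ⊙ (∏< Fₛ N ⊙ ∏< Fₜ N)
      ≈⟨ ⊙-congˡ[] (f c) (⊙-cong[] (∏∞-approx (qPoch⁺-factors→1 s c) D≤N) (∏∞-approx (qPoch⁺-factors→1 t c) D≤N)) ⟨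
    f c ⊙ (qPoch⁺ s c ⊙ qPoch⁺ t c) ∎
    where
    open ≈[]-Reasoning D
    N = suc (D + D)
    D≤N : D ≤ N
    D≤N = ℕₚ.≤-trans (ℕₚ.m≤m+n D D) (ℕₚ.n≤1+n _)
    large⁺ : ∀ j → suc N ≤ j → D < θexp s t j
    large⁺ j N<j = ℕₚ.≤-trans (s≤s D≤N) (ℕₚ.≤-trans N<j (θexp-inflationary s t j))
    large⁻ : ∀ j → N ≤ j → D < θexp t s (suc j)
    large⁻ j N≤j = ℕₚ.≤-trans (s≤s (ℕₚ.≤-trans D≤N N≤j)) (θexp-inflationary t s (suc j))

  jacobiTriple : θ s t ≈ f c ⊙ (qPoch⁺ s c ⊙ qPoch⁺ t c)
  jacobiTriple = ≈[]⇒≈ jacobiTriple≈[]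

  θ-quotient : θ s t ⊙ (qPoch s c ⊙ qPoch t c) ≈ f c ⊙ (qPoch (2 * s) (2 * c) ⊙ qPoch (2 * t) (2 * c))
  θ-quotient = begin
    θ s t ⊙ (qPoch s c ⊙ qPoch t c)                            ≈⟨ ⊙-congʳ _ jacobiTriple ⟩
    (f c ⊙ (qPoch⁺ s c ⊙ qPoch⁺ t c)) ⊙ (qPoch s c ⊙ qPoch t c) ≈⟨ ⊙-assoc (f c) _ _ ⟩
    f c ⊙ ((qPoch⁺ s c ⊙ qPoch⁺ t c) ⊙ (qPoch s c ⊙ qPoch t c)) ≈⟨ ⊙-congˡ (f c) (⊙.interchange _ _ _ _) ⟩
    f c ⊙ ((qPoch⁺ s c ⊙ qPoch s c) ⊙ (qPoch⁺ t c ⊙ qPoch t c))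
      ≈⟨ ⊙-congˡ (f c) (⊙-cong (qPoch⁺⊙qPoch s c) (qPoch⁺⊙qPoch t c)) ⟩
    f c ⊙ (qPoch (2 * s) (2 * c) ⊙ qPoch (2 * t) (2 * c))       ∎
    where open ≈-Reasoning

  -- Clearing the denominators of the Jacobi triple product turns an identity
  -- θ s t ⊙ ∏ Fs ≈ ∏ Gs into a comparison of products of (q^r; q^M)_∞.
  θ-by-residues : ∀ M {Fs Gs rss sss} →
    Pointwise (Residues._expandsTo_ M) (f c ∷ qPoch (2 * s) (2 * c) ∷ qPoch (2 * t) (2 * c) ∷ Fs) rss →
    Pointwise (Residues._expandsTo_ M) (qPoch s c ∷ qPoch t c ∷ Gs) sss →
    sort (concat rss) ≡ sort (concat sss) → θ s t ⊙ ∏ Fs ≈ ∏ Gs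
  θ-by-residues M {Fs} {Gs} numerators denominators same = ⊙-cancelʳ {qPoch s c ⊙ qPoch t c} refl (begin
    (θ s t ⊙ ∏ Fs) ⊙ Q                                       ≈⟨ ⊙.xy∙z≈xz∙y (θ s t) (∏ Fs) Q ⟩
    (θ s t ⊙ Q) ⊙ ∏ Fs                                       ≈⟨ ⊙-congʳ (∏ Fs) θ-quotient ⟩
    (f c ⊙ (A ⊙ B)) ⊙ ∏ Fs                                    ≈⟨ ⊙-assoc (f c) (A ⊙ B) (∏ Fs) ⟩
    f c ⊙ ((A ⊙ B) ⊙ ∏ Fs)                                    ≈⟨ ⊙-congˡ (f c) (⊙-assoc A B (∏ Fs)) ⟩
    f c ⊙ (A ⊙ (B ⊙ ∏ Fs))                                    ≈⟨ ⊙-congˡ (f c) (⊙-congˡ A (∏-∷ B Fs)) ⟨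
    ∏ (f c ∷ qPoch (2 * s) (2 * c) ∷ qPoch (2 * t) (2 * c) ∷ Fs)
      ≈⟨ Residues.∏-by-residues M numerators denominators same ⟩
    ∏ (qPoch s c ∷ qPoch t c ∷ Gs)                          ≈⟨ ⊙-congˡ (qPoch s c) (∏-∷ (qPoch t c) Gs) ⟩
    qPoch s c ⊙ (qPoch t c ⊙ ∏ Gs)                          ≈⟨ ⊙-assoc (qPoch s c) (qPoch t c) (∏ Gs) ⟨
    Q ⊙ ∏ Gs                                                ≈⟨ ⊙-comm Q (∏ Gs) ⟩
    ∏ Gs ⊙ Q                                                 ∎)
    where
    open ≈-Reasoning
    Q = qPoch s c ⊙ qPoch t c
    A = qPoch (2 * s) (2 * c)
    B = qPoch (2 * t) (2 * c)

-- Theta functions as eta quotients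

θ-1-5-eta : θ 1 5 ⊙ (f 1 ⊙ (f 4 ⊙ f 6)) ≈ f 2 ⊙ (f 2 ⊙ (f 3 ⊙ f 12))
θ-1-5-eta = θ-by-residues 1 5 12
  (f-expands 6 2 refl ∷ qPoch-expands 2 12 1 refl ∷ qPoch-expands 10 12 1 refl ∷
   f-expands 1 12 refl ∷ f-expands 4 3 refl ∷ f-expands 6 2 refl ∷ [])
  (qPoch-expands 1 6 2 refl ∷ qPoch-expands 5 6 2 refl ∷
   f-expands 2 6 refl ∷ f-expands 2 6 refl ∷ f-expands 3 4 refl ∷ f-expands 12 1 refl ∷ [])
  refl
  where open Residues 12

θ-1-1-eta : θ 1 1 ⊙ (f 1 ⊙ (f 1 ⊙ (f 4 ⊙ f 4))) ≈ f 2 ⊙ (f 2 ⊙ (f 2 ⊙ (f 2 ⊙ f 2)))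
θ-1-1-eta = θ-by-residues 1 1 4
  (f-expands 2 2 refl ∷ qPoch-expands 2 4 1 refl ∷ qPoch-expands 2 4 1 refl ∷
   f-expands 1 4 refl ∷ f-expands 1 4 refl ∷ f-expands 4 1 refl ∷ f-expands 4 1 refl ∷ [])
  (qPoch-expands 1 2 2 refl ∷ qPoch-expands 1 2 2 refl ∷
   f-expands 2 2 refl ∷ f-expands 2 2 refl ∷ f-expands 2 2 refl ∷ f-expands 2 2 refl ∷ f-expands 2 2 refl ∷ [])
  refl
  where open Residues 4

θ-2-4-eta : θ 2 4 ⊙ (f 2 ⊙ f 12) ≈ f 4 ⊙ (f 6 ⊙ f 6)
θ-2-4-eta = θ-by-residues 2 4 12
  (f-expands 6 2 refl ∷ qPoch-expands 4 12 1 refl ∷ qPoch-expands 8 12 1 refl ∷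
   f-expands 2 6 refl ∷ f-expands 12 1 refl ∷ [])
  (qPoch-expands 2 6 2 refl ∷ qPoch-expands 4 6 2 refl ∷
   f-expands 4 3 refl ∷ f-expands 6 2 refl ∷ f-expands 6 2 refl ∷ [])
  refl
  where open Residues 12

θ-12-4-eta : θ 12 4 ⊙ f 4 ≈ f 8 ⊙ f 8
θ-12-4-eta = θ-by-residues 12 4 32
  (f-expands 16 2 refl ∷ qPoch-expands 24 32 1 refl ∷ qPoch-expands 8 32 1 refl ∷ f-expands 4 8 refl ∷ [])
  (qPoch-expands 12 16 2 refl ∷ qPoch-expands 4 16 2 refl ∷ f-expands 8 4 refl ∷ f-expands 8 4 refl ∷ [])
  refl
  where open Residues 32

-- Partitions without parts ≡ 3 (mod 6)

private
  if-≤ᵇ : ∀ {A : Set} {m n} {x y : A} → m ≤ n → (if m ≤ᵇ n then x else y) ≡ x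
  if-≤ᵇ {m = m} {n} m≤n with m ≤ᵇ n | ℕₚ.≤⇒≤ᵇ m≤n
  ... | true | _ = refl

  if-≰ᵇ : ∀ {A : Set} {m n} {x y : A} → n < m → (if m ≤ᵇ n then x else y) ≡ y
  if-≰ᵇ {m = m} {n} n<m with m ≤ᵇ n | ℕₚ.≤ᵇ-reflects-≤ m n
  ... | true  | ofʸ m≤n = contradiction m≤n (ℕₚ.<⇒≱ n<m)
  ... | false | _       = refl

  sum-zero : ∀ h B → (∀ c → h c ≡ 0) → sum (applyUpTo h B) ≡ 0
  sum-zero h zero    h≡0 = refl
  sum-zero h (suc B) h≡0 = cong₂ _+_ (h≡0 0) (sum-zero (h ∘ suc) B (h≡0 ∘ suc))

  sum-vanishing : ∀ h {B B′} → (∀ c → B ≤ c → h c ≡ 0) → B ≤ B′ → sum (applyUpTo h B′) ≡ sum (applyUpTo h B)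
  sum-vanishing h {zero}  {B′}     h≡0 _           = sum-zero h B′ (λ c → h≡0 c z≤n)
  sum-vanishing h {suc B} {suc B′} h≡0 (s≤s B≤B′) =
    cong (_+_ (h 0)) (sum-vanishing (h ∘ suc) (λ c B≤c → h≡0 (suc c) (s≤s B≤c)) B≤B′)

  sum-cong : ∀ {h h′} B → (∀ c → h c ≡ h′ c) → sum (applyUpTo h B) ≡ sum (applyUpTo h′ B)
  sum-cong zero    h≡ = refl
  sum-cong (suc B) h≡ = cong₂ _+_ (h≡ 0) (sum-cong B (h≡ ∘ suc))

-- The coefficient of qⁿ in R(q) / (1 - qᵏ), written as in Defs.P.
geoSum : ℕ → (ℕ → ℕ) → ℕ → ℕ
geoSum k R n = sum (map (λ c → if c * k ≤ᵇ n then R (n ∸ c * k) else 0) (upTo (suc n)))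

module _ (k : ℕ) .{{_ : NonZero k}} (R : ℕ → ℕ) where

  private
    term : ℕ → ℕ → ℕ
    term n c = if c * k ≤ᵇ n then R (n ∸ c * k) else 0

    geoSum≡ : ∀ n → geoSum k R n ≡ sum (applyUpTo (term n) (suc n))
    geoSum≡ n = cong sum (map-applyUpTo (term n) id (suc n))

    beyond : ∀ n c → n < c → term n c ≡ 0
    beyond n c n<c = if-≰ᵇ (ℕₚ.<-≤-trans n<c (ℕₚ.m≤m*n c k))

  geoSum-≥ : ∀ {n} → k ≤ n → geoSum k R n ≡ R n + geoSum k R (n ∸ k)
  geoSum-≥ {n} k≤n = begin
    geoSum k R n                                       ≡⟨ geoSum≡ n ⟩
    R n + sum (applyUpTo (term n ∘ suc) n)             ≡⟨ cong (_+_ (R n)) (sum-cong n shifted) ⟩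
    R n + sum (applyUpTo (term (n ∸ k)) n)
      ≡⟨ cong (_+_ (R n)) (sum-vanishing (term (n ∸ k)) (beyond (n ∸ k))
                                                                              (ℕₚ.∸-monoʳ-< (ℕ.>-nonZero⁻¹ k) k≤n)) ⟩
    R n + sum (applyUpTo (term (n ∸ k)) (suc (n ∸ k))) ≡⟨ cong (_+_ (R n)) (geoSum≡ (n ∸ k)) ⟨
    R n + geoSum k R (n ∸ k)                           ∎
    where
    open ≡-Reasoning
    shifted : ∀ c → term n (suc c) ≡ term (n ∸ k) c
    shifted c with c * k ≤? n ∸ k
    ... | yes ck≤n-k = trans (if-≤ᵇ (subst (k + c * k ≤_) (ℕₚ.m+[n∸m]≡n k≤n) (ℕₚ.+-monoʳ-≤ k ck≤n-k)))
                             (trans (cong R (sym (ℕₚ.∸-+-assoc n k (c * k)))) (sym (if-≤ᵇ ck≤n-k)))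
    ... | no ck≰n-k = trans
      (if-≰ᵇ (ℕₚ.≰⇒> λ k+ck≤n → ck≰n-k (ℕₚ.m+n≤o⇒m≤o∸n (c * k) (subst (_≤ n) (ℕₚ.+-comm k (c * k)) k+ck≤n))))
                            (sym (if-≰ᵇ (ℕₚ.≰⇒> ck≰n-k)))

  geoSum-< : ∀ {n} → n < k → geoSum k R n ≡ R n
  geoSum-< {n} n<k = trans (geoSum≡ n) (trans (cong (_+_ (R n)) (sum-zero (term n ∘ suc) n vanish)) (ℕₚ.+-identityʳ (R n)))
    where
    vanish : ∀ c → term n (suc c) ≡ 0
    vanish c = if-≰ᵇ (ℕₚ.<-≤-trans n<k (ℕₚ.m≤m+n k (c * k)))

  1-q^⊙geoSum : 1-q^ k ⊙ (λ n → + geoSum k R n) ≈ (λ n → + R n)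
  1-q^⊙geoSum = ≈-trans (1-q^-⊙ k _) (coeffwise go)
    where
    go : ∀ n → + geoSum k R n ℤ.+ ℤ.- shiftBy k (λ n → + geoSum k R n) n ≡ + R n
    go n with k ≤? n
    ... | yes k≤n = begin
      + geoSum k R n ℤ.+ ℤ.- shiftBy k G n
        ≡⟨ cong₂ (λ x y → x ℤ.+ ℤ.- y) (trans (cong +_ (geoSum-≥ k≤n)) (ℤₚ.pos-+ (R n) _)) (shiftBy-≥ k G k≤n) ⟩
      (+ R n ℤ.+ + geoSum k R (n ∸ k)) ℤ.+ ℤ.- + geoSum k R (n ∸ k)
                                                        ≡⟨ ℤₚ.+-assoc (+ R n) (+ geoSum k R (n ∸ k)) (ℤ.- + geoSum k R (n ∸ k)) ⟩
      + R n ℤ.+ (+ geoSum k R (n ∸ k) ℤ.+ ℤ.- + geoSum k R (n ∸ k))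
                                                        ≡⟨ cong (ℤ._+_ (+ R n)) (ℤₚ.+-inverseʳ (+ geoSum k R (n ∸ k))) ⟩
      + R n ℤ.+ + 0                                     ≡⟨ ℤₚ.+-identityʳ (+ R n) ⟩
      + R n                                             ∎
      where
      open ≡-Reasoning
      G = λ n → + geoSum k R n
    ... | no k≰n = trans (cong₂ (λ x y → x ℤ.+ ℤ.- y) (cong +_ (geoSum-< (ℕₚ.≰⇒> k≰n))) (shiftBy-< k _ (ℕₚ.≰⇒> k≰n)))
                         (ℤₚ.+-identityʳ (+ R n))

-- As in Defs.P, index m stands for the part size suc m.
excluded : ℕ → Bool
excluded m = (suc m % 6) ≡ᵇ 3

allowedFactor excludedFactor : ℕ → FPS
allowedFactor  m = if excluded m then one else 1-q^ (suc m)
excludedFactor m = if excluded m then 1-q^ (suc m) else one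

Pseries : ℕ → FPS
Pseries m n = + P m n

partitionSeries : FPS
partitionSeries n = + a n

∏<-allowed⊙P : ∀ m → ∏< allowedFactor m ⊙ Pseries m ≈ one
∏<-allowed⊙P zero    = ≈-trans (⊙-identityˡ (Pseries 0)) (coeffwise λ { zero → refl ; (suc n) → refl })
∏<-allowed⊙P (suc m) with excluded m
... | true  = ≈-trans (⊙-congʳ (Pseries m) (*-identityʳ _)) (∏<-allowed⊙P m)
... | false = begin
  (∏< allowedFactor m ⊙ 1-q^ (suc m)) ⊙ (λ n → + geoSum (suc m) (P m) n) ≈⟨ ⊙-assoc _ _ _ ⟩
  ∏< allowedFactor m ⊙ (1-q^ (suc m) ⊙ (λ n → + geoSum (suc m) (P m) n))
    ≈⟨ ⊙-congˡ (∏< allowedFactor m) (1-q^⊙geoSum (suc m) (P m)) ⟩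
  ∏< allowedFactor m ⊙ Pseries m                                               ≈⟨ ∏<-allowed⊙P m ⟩
  one                                                                     ∎
  where open ≈-Reasoning

P-stable : ∀ n d → P (n + d) n ≡ P n n
P-stable n zero    = cong (λ m → P m n) (ℕₚ.+-identityʳ n)
P-stable n (suc d) = trans (cong (λ m → P m n) (ℕₚ.+-suc n d)) (trans (large-parts (n + d) (ℕₚ.m≤m+n n d)) (P-stable n d))
  where
  large-parts : ∀ m → n ≤ m → P (suc m) n ≡ P m n
  large-parts m n≤m with excluded m
  ... | true  = refl
  ... | false = geoSum-< (suc m) (P m) (s≤s n≤m)

partitionSeries≈[]Pseries : ∀ D → partitionSeries ≈[ D ] Pseries D
partitionSeries≈[]Pseries D = agreeUpTo λ n n≤D →
  cong +_ (sym (trans (cong (λ m → P m n) (sym (ℕₚ.m+[n∸m]≡n n≤D))) (P-stable n (D ∸ n))))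

allowed→1 : TendsToOne allowedFactor
allowed→1 {D} {k} D≤k with excluded k
... | true  = ≈⇒≈[] D ≈-refl
... | false = 1-q^-≈[]one (s≤s D≤k)

excluded→1 : TendsToOne excludedFactor
excluded→1 {D} {k} D≤k with excluded k
... | true  = 1-q^-≈[]one (s≤s D≤k)
... | false = ≈⇒≈[] D ≈-refl

∏∞-allowed⊙partitionSeries : ∏∞ allowedFactor ⊙ partitionSeries ≈ one
∏∞-allowed⊙partitionSeries = ≈[]⇒≈ λ D → ≈[]-trans
  (⊙-cong[] (∏∞-approx allowed→1 ℕₚ.≤-refl) (partitionSeries≈[]Pseries D)) (≈⇒≈[] D (∏<-allowed⊙P D))

excluded-periodic : ∀ k r → excluded (k * 6 + r) ≡ excluded r
excluded-periodic k r = cong (_≡ᵇ 3) (trans (cong (_% 6) (reindex k r)) ([m+kn]%n≡m%n (suc r) k 6))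
  where
  reindex : ∀ k r → suc (k * 6 + r) ≡ suc r + k * 6
  reindex = solve-∀

∏∞-excluded : ∏∞ excludedFactor ≈ qPoch 3 6
∏∞-excluded = begin
  ∏∞ excludedFactor                                     ≈⟨ ∏∞-residues excluded→1 6 ⟩
  ∏< (λ r → ∏∞ (λ k → excludedFactor (k * 6 + r))) 6   ≈⟨ ∏<-cong-< 6 residue-class ⟩
  (((((one ⊙ one) ⊙ one) ⊙ qPoch 3 6) ⊙ one) ⊙ one) ⊙ one
    ≈⟨ ≈-trans (*-identityʳ _) (≈-trans (*-identityʳ _) (*-identityʳ _)) ⟩
  ((one ⊙ one) ⊙ one) ⊙ qPoch 3 6
    ≈⟨ ⊙-congʳ (qPoch 3 6) (≈-trans (*-identityʳ _) (*-identityʳ one)) ⟩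
  one ⊙ qPoch 3 6                                       ≈⟨ ⊙-identityˡ (qPoch 3 6) ⟩
  qPoch 3 6                                             ∎
  where
  open ≈-Reasoning
  exponent : ∀ k → suc (k * 6 + 2) ≡ 3 + k * 6
  exponent = solve-∀
  residue-class : ∀ r → r < 6 → ∏∞ (λ k → excludedFactor (k * 6 + r)) ≈ (if r ≡ᵇ 2 then qPoch 3 6 else one)
  residue-class r r<6 = ≈-trans
    (∏∞-cong λ k → ≡⇒≈ (cong (λ b → if b then 1-q^ (suc (k * 6 + r)) else one) (excluded-periodic k r)))
                                (by-cases r r<6)
    where
    by-cases : ∀ r → r < 6 →
      ∏∞ (λ k → if excluded r then 1-q^ (suc (k * 6 + r)) else one) ≈ (if r ≡ᵇ 2 then qPoch 3 6 else one)
    by-cases 0 _ = ∏∞-one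
    by-cases 1 _ = ∏∞-one
    by-cases 2 _ = ∏∞-cong λ k → ≡⇒≈ (cong 1-q^_ (exponent k))
    by-cases 3 _ = ∏∞-one
    by-cases 4 _ = ∏∞-one
    by-cases 5 _ = ∏∞-one
    by-cases (suc (suc (suc (suc (suc (suc r)))))) (s≤s (s≤s (s≤s (s≤s (s≤s (s≤s ())))))) 

∏∞-allowed⊙qPoch : ∏∞ allowedFactor ⊙ qPoch 3 6 ≈ f 1
∏∞-allowed⊙qPoch = begin
  ∏∞ allowedFactor ⊙ qPoch 3 6                              ≈⟨ ⊙-congˡ (∏∞ allowedFactor) ∏∞-excluded ⟨
  ∏∞ allowedFactor ⊙ ∏∞ excludedFactor                      ≈⟨ ∏∞-⊙ allowed→1 excluded→1 ⟩
  ∏∞ (λ m → allowedFactor m ⊙ excludedFactor m)             ≈⟨ ∏∞-cong factor ⟩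
  qPoch 1 1                                                 ≈⟨ f≈qPoch 1 ⟨
  f 1                                                       ∎
  where
  open ≈-Reasoning
  factor : ∀ m → allowedFactor m ⊙ excludedFactor m ≈ 1-q^ (1 + m * 1)
  factor m with excluded m
  ... | true  = ≈-trans (⊙-identityˡ _) (≡⇒≈ (cong (1-q^_ ∘ suc) (sym (ℕₚ.*-identityʳ m))))
  ... | false = ≈-trans (*-identityʳ _) (≡⇒≈ (cong (1-q^_ ∘ suc) (sym (ℕₚ.*-identityʳ m))))

f3-split : f 3 ≈ qPoch 3 6 ⊙ f 6
f3-split = ∏-by-residues (f-expands 3 2 refl ∷ []) (qPoch-expands 3 6 1 refl ∷ f-expands 6 1 refl ∷ []) refl
  where open Residues 6

partitionSeries-eta : partitionSeries ⊙ (f 1 ⊙ f 6) ≈ f 3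
partitionSeries-eta = begin
  A ⊙ (f 1 ⊙ f 6)                              ≈⟨ ⊙-congˡ A (⊙-congʳ (f 6) ∏∞-allowed⊙qPoch) ⟨
  A ⊙ ((∏∞ allowedFactor ⊙ qPoch 3 6) ⊙ f 6)   ≈⟨ regroup A (∏∞ allowedFactor) (qPoch 3 6) (f 6) ⟩
  (∏∞ allowedFactor ⊙ A) ⊙ (qPoch 3 6 ⊙ f 6)   ≈⟨ ⊙-congʳ (qPoch 3 6 ⊙ f 6) ∏∞-allowed⊙partitionSeries ⟩
  one ⊙ (qPoch 3 6 ⊙ f 6)                      ≈⟨ ⊙-identityˡ _ ⟩
  qPoch 3 6 ⊙ f 6                              ≈⟨ f3-split ⟨
  f 3                                          ∎
  where
  open ≈-Reasoning
  A = partitionSeries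
  regroup : ∀ a l q g → a ⊙ ((l ⊙ q) ⊙ g) ≈ (l ⊙ a) ⊙ (q ⊙ g)
  regroup = solve 4 (λ a l q g → a :* ((l :* q) :* g) := (l :* a) :* (q :* g)) ≈-refl
    where open ⊙-Solver

partitionSeries-θ : partitionSeries ⊙ (f 2 ⊙ (f 2 ⊙ f 12)) ≈ f 4 ⊙ θ 1 5
partitionSeries-θ = ⊙-cancelʳ {f 1 ⊙ f 6} refl (begin
  (A ⊙ (f 2 ⊙ (f 2 ⊙ f 12))) ⊙ (f 1 ⊙ f 6)    ≈⟨ ⊙.xy∙z≈xz∙y A _ _ ⟩
  (A ⊙ (f 1 ⊙ f 6)) ⊙ (f 2 ⊙ (f 2 ⊙ f 12))    ≈⟨ ⊙-congʳ (f 2 ⊙ (f 2 ⊙ f 12)) partitionSeries-eta ⟩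
  f 3 ⊙ (f 2 ⊙ (f 2 ⊙ f 12))                  ≈⟨ regroup (f 2) (f 3) (f 12) ⟩
  f 2 ⊙ (f 2 ⊙ (f 3 ⊙ f 12))                  ≈⟨ θ-1-5-eta ⟨
  θ 1 5 ⊙ (f 1 ⊙ (f 4 ⊙ f 6))                 ≈⟨ regroup′ (θ 1 5) (f 1) (f 4) (f 6) ⟩
  (f 4 ⊙ θ 1 5) ⊙ (f 1 ⊙ f 6)                 ∎)
  where
  open ≈-Reasoning
  open ⊙-Solver
  A = partitionSeries
  regroup : ∀ x y z → y ⊙ (x ⊙ (x ⊙ z)) ≈ x ⊙ (x ⊙ (y ⊙ z))
  regroup = solve 3 (λ x y z → y :* (x :* (x :* z)) := x :* (x :* (y :* z))) ≈-refl
  regroup′ : ∀ t a b c → t ⊙ (a ⊙ (b ⊙ c)) ≈ (b ⊙ t) ⊙ (a ⊙ c)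
  regroup′ = solve 4 (λ t a b c → t :* (a :* (b :* c)) := (b :* t) :* (a :* c)) ≈-refl

evenPart-partitionSeries : (f 1 ⊙ (f 1 ⊙ f 6)) ⊙ evenPart partitionSeries ≈ f 2 ⊙ dilate (θ 2 4)
evenPart-partitionSeries = begin
  Z ⊙ evenPart A                                 ≈⟨ evenPart-dilate⊙ Z A ⟨
  evenPart (dilate Z ⊙ A)                        ≈⟨ evenPart-cong (⊙-congʳ A dilate-Z) ⟩
  evenPart ((f 2 ⊙ (f 2 ⊙ f 12)) ⊙ A)            ≈⟨ evenPart-cong (≈-trans (⊙-comm _ A) partitionSeries-θ) ⟩
  evenPart (f 4 ⊙ θ 1 5)                         ≈⟨ evenPart-cong (⊙-congʳ (θ 1 5) (dilate-f 2)) ⟨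
  evenPart (dilate (f 2) ⊙ θ 1 5)                ≈⟨ evenPart-dilate⊙ (f 2) (θ 1 5) ⟩
  f 2 ⊙ evenPart (θ 1 5)                         ≈⟨ ⊙-congˡ (f 2) (evenPart-θ 0 2) ⟩
  f 2 ⊙ θ 4 8                                    ≈⟨ ⊙-congˡ (f 2) (dilate-θ 2 4) ⟨
  f 2 ⊙ dilate (θ 2 4)                           ∎
  where
  open ≈-Reasoning
  A = partitionSeries
  Z = f 1 ⊙ (f 1 ⊙ f 6)
  dilate-Z : dilate Z ≈ f 2 ⊙ (f 2 ⊙ f 12)
  dilate-Z = ≈-trans (dilate-f⊙ 1 _) (⊙-congˡ (f 2) (≈-trans (dilate-f⊙ 1 (f 6)) (⊙-congˡ (f 2) (dilate-f 6))))

dilated-partitionSeries : dilate (f 1 ⊙ (f 1 ⊙ (f 1 ⊙ (f 1 ⊙ f 3)))) ⊙ evenPart partitionSeries ≈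
                          dilate (θ 2 4 ⊙ (f 2 ⊙ f 2)) ⊙ θ 1 1
dilated-partitionSeries = ⊙-cancelʳ {f 2} refl (begin
  (dilate (f 1 ⊙ (f 1 ⊙ (f 1 ⊙ (f 1 ⊙ f 3)))) ⊙ S) ⊙ f 2
    ≈⟨ ⊙-congʳ (f 2) (⊙-congʳ S dilate-f₁⁴f₃) ⟩
  ((f 2 ⊙ (f 2 ⊙ (f 2 ⊙ (f 2 ⊙ f 6)))) ⊙ S) ⊙ f 2
    ≈⟨ regroup₁ (f 2) (f 6) S ⟩
  (f 2 ⊙ (f 2 ⊙ (f 2 ⊙ (f 2 ⊙ f 2)))) ⊙ (f 6 ⊙ S)
    ≈⟨ ⊙-congʳ (f 6 ⊙ S) θ-1-1-eta ⟨
  (θ 1 1 ⊙ (f 1 ⊙ (f 1 ⊙ (f 4 ⊙ f 4)))) ⊙ (f 6 ⊙ S)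
    ≈⟨ regroup₂ (θ 1 1) (f 1) (f 4) (f 6) S ⟩
  (θ 1 1 ⊙ (f 4 ⊙ f 4)) ⊙ ((f 1 ⊙ (f 1 ⊙ f 6)) ⊙ S)
    ≈⟨ ⊙-congˡ (θ 1 1 ⊙ (f 4 ⊙ f 4)) evenPart-partitionSeries ⟩
  (θ 1 1 ⊙ (f 4 ⊙ f 4)) ⊙ (f 2 ⊙ dilate (θ 2 4))
    ≈⟨ regroup₃ (θ 1 1) (f 4) (f 2) (dilate (θ 2 4)) ⟩
  ((dilate (θ 2 4) ⊙ (f 4 ⊙ f 4)) ⊙ θ 1 1) ⊙ f 2
    ≈⟨ ⊙-congʳ (f 2) (⊙-congʳ (θ 1 1) dilate-θ₂₄f₂²) ⟨
  (dilate (θ 2 4 ⊙ (f 2 ⊙ f 2)) ⊙ θ 1 1) ⊙ f 2 ∎)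
  where
  open ≈-Reasoning
  open ⊙-Solver
  S = evenPart partitionSeries
  dilate-f₁⁴f₃ : dilate (f 1 ⊙ (f 1 ⊙ (f 1 ⊙ (f 1 ⊙ f 3)))) ≈ f 2 ⊙ (f 2 ⊙ (f 2 ⊙ (f 2 ⊙ f 6)))
  dilate-f₁⁴f₃ = ≈-trans (dilate-f⊙ 1 _) (⊙-congˡ (f 2) (≈-trans (dilate-f⊙ 1 _) (⊙-congˡ (f 2)
    (≈-trans (dilate-f⊙ 1 _) (⊙-congˡ (f 2) (≈-trans (dilate-f⊙ 1 (f 3)) (⊙-congˡ (f 2) (dilate-f 3))))))))
  dilate-θ₂₄f₂² : dilate (θ 2 4 ⊙ (f 2 ⊙ f 2)) ≈ dilate (θ 2 4) ⊙ (f 4 ⊙ f 4)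
  dilate-θ₂₄f₂² = ≈-trans (dilate-⊙ (θ 2 4) _)
    (⊙-congˡ (dilate (θ 2 4)) (≈-trans (dilate-f⊙ 2 (f 2)) (⊙-congˡ (f 4) (dilate-f 2))))
  regroup₁ : ∀ x y s → ((x ⊙ (x ⊙ (x ⊙ (x ⊙ y)))) ⊙ s) ⊙ x ≈ (x ⊙ (x ⊙ (x ⊙ (x ⊙ x)))) ⊙ (y ⊙ s)
  regroup₁ = solve 3 (λ x y s → ((x :* (x :* (x :* (x :* y)))) :* s) :* x := (x :* (x :* (x :* (x :* x)))) :* (y :* s)) ≈-refl
  regroup₂ : ∀ t a b c s → (t ⊙ (a ⊙ (a ⊙ (b ⊙ b)))) ⊙ (c ⊙ s) ≈ (t ⊙ (b ⊙ b)) ⊙ ((a ⊙ (a ⊙ c)) ⊙ s)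
  regroup₂ = solve 5 (λ t a b c s → (t :* (a :* (a :* (b :* b)))) :* (c :* s) := (t :* (b :* b)) :* ((a :* (a :* c)) :* s)) ≈-refl
  regroup₃ : ∀ t b x d → (t ⊙ (b ⊙ b)) ⊙ (x ⊙ d) ≈ ((d ⊙ (b ⊙ b)) ⊙ t) ⊙ x
  regroup₃ = solve 4 (λ t b x d → (t :* (b :* b)) :* (x :* d) := ((d :* (b :* b)) :* t) :* x) ≈-refl

oddPart-θ-1-1 : oddPart (θ 1 1) ≈ θ 12 4 ⊕ θ 12 4
oddPart-θ-1-1 = ≈-trans (oddPart-θ 0 0) (⊕-cong ψ ψ)
  where
  pronic : ∀ m → 2 * (m * suc m) + (2 * m + 1) * (suc m * 0 + m * 0) ≡ 2 * (m * suc m)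
  pronic = solve-∀
  ψ : monoSum (θodd 0 0) ≈ θ 12 4
  ψ = ≈-trans (monoSum-cong pronic) (monoSum-pronic 2)

oddPart-evenPart-partitionSeries : (f 1 ⊙ (f 1 ⊙ (f 1 ⊙ (f 1 ⊙ f 3)))) ⊙ oddPart (evenPart partitionSeries) ≈
                                   (θ 2 4 ⊙ (f 2 ⊙ f 2)) ⊙ (θ 12 4 ⊕ θ 12 4)
oddPart-evenPart-partitionSeries = begin
  W ⊙ oddPart S                            ≈⟨ oddPart-dilate⊙ W S ⟨
  oddPart (dilate W ⊙ S)                   ≈⟨ oddPart-cong dilated-partitionSeries ⟩
  oddPart (dilate V ⊙ θ 1 1)               ≈⟨ oddPart-dilate⊙ V (θ 1 1) ⟩
  V ⊙ oddPart (θ 1 1)                      ≈⟨ ⊙-congˡ V oddPart-θ-1-1 ⟩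
  V ⊙ (θ 12 4 ⊕ θ 12 4)                    ∎
  where
  open ≈-Reasoning
  S = evenPart partitionSeries
  W = f 1 ⊙ (f 1 ⊙ (f 1 ⊙ (f 1 ⊙ f 3)))
  V = θ 2 4 ⊙ (f 2 ⊙ f 2)

partitions-4n+2 : oddPart (evenPart partitionSeries) ⊙ (f 1 ⊙ (f 1 ⊙ (f 1 ⊙ (f 1 ⊙ (f 3 ⊙ f 12))))) ≈
                  f 2 ⊙ (f 6 ⊙ (f 6 ⊙ (f 8 ⊙ f 8))) ⊕ f 2 ⊙ (f 6 ⊙ (f 6 ⊙ (f 8 ⊙ f 8)))
partitions-4n+2 = ⊙-cancelʳ {f 4} refl (begin
  (T ⊙ (f 1 ⊙ (f 1 ⊙ (f 1 ⊙ (f 1 ⊙ (f 3 ⊙ f 12)))))) ⊙ f 4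
    ≈⟨ regroup₁ T (f 1) (f 3) (f 12) (f 4) ⟩
  ((f 1 ⊙ (f 1 ⊙ (f 1 ⊙ (f 1 ⊙ f 3)))) ⊙ T) ⊙ (f 12 ⊙ f 4)
    ≈⟨ ⊙-congʳ (f 12 ⊙ f 4) oddPart-evenPart-partitionSeries ⟩
  ((θ 2 4 ⊙ (f 2 ⊙ f 2)) ⊙ (θ 12 4 ⊕ θ 12 4)) ⊙ (f 12 ⊙ f 4)
    ≈⟨ regroup₂ (θ 2 4) (f 2) (θ 12 4) (f 12) (f 4) ⟩
  ((θ 2 4 ⊙ (f 2 ⊙ f 12)) ⊙ f 2) ⊙ (θ 12 4 ⊙ f 4 ⊕ θ 12 4 ⊙ f 4)
    ≈⟨ ⊙-cong (⊙-congʳ (f 2) θ-2-4-eta) (⊕-cong θ-12-4-eta θ-12-4-eta) ⟩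
  ((f 4 ⊙ (f 6 ⊙ f 6)) ⊙ f 2) ⊙ (f 8 ⊙ f 8 ⊕ f 8 ⊙ f 8)
    ≈⟨ regroup₃ (f 2) (f 4) (f 6) (f 8) ⟩
  (f 2 ⊙ (f 6 ⊙ (f 6 ⊙ (f 8 ⊙ f 8))) ⊕ f 2 ⊙ (f 6 ⊙ (f 6 ⊙ (f 8 ⊙ f 8)))) ⊙ f 4 ∎)
  where
  open ≈-Reasoning
  open ⊙-Solver
  T = oddPart (evenPart partitionSeries)
  regroup₁ : ∀ t a b c d → (t ⊙ (a ⊙ (a ⊙ (a ⊙ (a ⊙ (b ⊙ c)))))) ⊙ d ≈ ((a ⊙ (a ⊙ (a ⊙ (a ⊙ b)))) ⊙ t) ⊙ (c ⊙ d)
  regroup₁ = solve 5 (λ t a b c d → (t :* (a :* (a :* (a :* (a :* (b :* c)))))) :* d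
                                 := ((a :* (a :* (a :* (a :* b)))) :* t) :* (c :* d)) ≈-refl
  regroup₂ : ∀ θ₁ x θ₂ y z → ((θ₁ ⊙ (x ⊙ x)) ⊙ (θ₂ ⊕ θ₂)) ⊙ (y ⊙ z) ≈ ((θ₁ ⊙ (x ⊙ y)) ⊙ x) ⊙ (θ₂ ⊙ z ⊕ θ₂ ⊙ z)
  regroup₂ = solve 5 (λ θ₁ x θ₂ y z → ((θ₁ :* (x :* x)) :* (θ₂ :+ θ₂)) :* (y :* z)
                                   := ((θ₁ :* (x :* y)) :* x) :* (θ₂ :* z :+ θ₂ :* z)) ≈-refl
  regroup₃ : ∀ a b c d → ((b ⊙ (c ⊙ c)) ⊙ a) ⊙ (d ⊙ d ⊕ d ⊙ d) ≈ (a ⊙ (c ⊙ (c ⊙ (d ⊙ d))) ⊕ a ⊙ (c ⊙ (c ⊙ (d ⊙ d)))) ⊙ b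
  regroup₃ = solve 4 (λ a b c d → ((b :* (c :* c)) :* a) :* (d :* d :+ d :* d)
                                := (a :* (c :* (c :* (d :* d))) :+ a :* (c :* (c :* (d :* d)))) :* b) ≈-refl

numerator-⊙ : f 2 ⊛ (f 6 ^^ 2) ⊛ (f 8 ^^ 2) ≈ f 2 ⊙ (f 6 ⊙ (f 6 ⊙ (f 8 ⊙ f 8)))
numerator-⊙ = begin
  (f 2 ⊛ (f 6 ^^ 2)) ⊛ (f 8 ^^ 2)       ≈⟨ ⊛≈⊙ _ (f 8 ^^ 2) ⟩
  (f 2 ⊛ (f 6 ^^ 2)) ⊙ (f 8 ^^ 2)
    ≈⟨ ⊙-cong (≈-trans (⊛≈⊙ (f 2) _) (⊙-congˡ (f 2) (square (f 6)))) (square (f 8)) ⟩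
  (f 2 ⊙ (f 6 ⊙ f 6)) ⊙ (f 8 ⊙ f 8)     ≈⟨ regroup (f 2) (f 6) (f 8) ⟩
  f 2 ⊙ (f 6 ⊙ (f 6 ⊙ (f 8 ⊙ f 8)))     ∎
  where
  open ≈-Reasoning
  open ⊙-Solver
  regroup : ∀ a b c → (a ⊙ (b ⊙ b)) ⊙ (c ⊙ c) ≈ a ⊙ (b ⊙ (b ⊙ (c ⊙ c)))
  regroup = solve 3 (λ a b c → (a :* (b :* b)) :* (c :* c) := a :* (b :* (b :* (c :* c)))) ≈-refl

denominator-⊙ : (f 1 ^^ 4) ⊛ f 3 ⊛ f 12 ≈ f 1 ⊙ (f 1 ⊙ (f 1 ⊙ (f 1 ⊙ (f 3 ⊙ f 12))))
denominator-⊙ = begin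
  ((f 1 ^^ 4) ⊛ f 3) ⊛ f 12             ≈⟨ ≈-trans (⊛≈⊙ _ (f 12)) (⊙-congʳ (f 12) (⊛≈⊙ (f 1 ^^ 4) (f 3))) ⟩
  ((f 1 ^^ 4) ⊙ f 3) ⊙ f 12             ≈⟨ ⊙-congʳ (f 12) (⊙-congʳ (f 3) fourth) ⟩
  ((f 1 ⊙ (f 1 ⊙ (f 1 ⊙ f 1))) ⊙ f 3) ⊙ f 12 ≈⟨ regroup (f 1) (f 3) (f 12) ⟩
  f 1 ⊙ (f 1 ⊙ (f 1 ⊙ (f 1 ⊙ (f 3 ⊙ f 12)))) ∎
  where
  open ≈-Reasoning
  open ⊙-Solver
  fourth : f 1 ^^ 4 ≈ f 1 ⊙ (f 1 ⊙ (f 1 ⊙ f 1))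
  fourth = ≈-trans (^^-suc (f 1) 3) (⊙-congˡ (f 1) (≈-trans (^^-suc (f 1) 2) (⊙-congˡ (f 1) (square (f 1)))))
  regroup : ∀ a b c → ((a ⊙ (a ⊙ (a ⊙ a))) ⊙ b) ⊙ c ≈ a ⊙ (a ⊙ (a ⊙ (a ⊙ (b ⊙ c))))
  regroup = solve 3 (λ a b c → ((a :* (a :* (a :* a))) :* b) :* c := a :* (a :* (a :* (a :* (b :* c))))) ≈-refl

theorem3 : (n : ℕ) → + a (4 * n + 2)
    ≡ ((+ 2) · (f 2 ⊛ (f 6 ^^ 2) ⊛ (f 8 ^^ 2)
    ⊛ inv ((f 1 ^^ 4) ⊛ f 3 ⊛ f 12))) n
theorem3 n = trans (cong (λ m → + a m) (sym (double-4n+2 n))) (coeff series n)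
  where
  Num Den N : FPS
  Num = f 2 ⊛ (f 6 ^^ 2) ⊛ (f 8 ^^ 2)
  Den = (f 1 ^^ 4) ⊛ f 3 ⊛ f 12
  N   = f 2 ⊙ (f 6 ⊙ (f 6 ⊙ (f 8 ⊙ f 8)))
  series : oddPart (evenPart partitionSeries) ≈ (+ 2) · (Num ⊛ inv Den)
  series = begin
    oddPart (evenPart partitionSeries)  ≈⟨ ⊙-divideʳ refl (≈-trans (⊙-congˡ _ denominator-⊙) partitions-4n+2) ⟩
    (N ⊕ N) ⊙ inv Den                   ≈⟨ ⊙-distribʳ (inv Den) N N ⟩
    N ⊙ inv Den ⊕ N ⊙ inv Den           ≈⟨ ⊕-self (N ⊙ inv Den) ⟩
    (+ 2) · (N ⊙ inv Den)               ≈⟨ ·-congˡ (+ 2) (≈-trans (⊛≈⊙ Num (inv Den)) (⊙-congʳ (inv Den) numerator-⊙)) ⟨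
    (+ 2) · (Num ⊛ inv Den)             ∎
    where open ≈-Reasoning
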